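{- Let $T$ be the complex permutation representation of $S_n$ arising from the action of $S_n$ on the power set of $\{1,\dots,n\}$, given by $\pi\cdot A=\pi(A)$. For $\pi,\sigma\in S_n$, if $T(\pi)$ and $T(\sigma)$ are similar matrices, then $\pi$ and $\sigma$ are conjugate in $S_n$.
   Context: The permutation representation associated with an action of a group on a finite set $X$ sends a group element to the $|X|\times|X|$ permutation matrix of its action on $X$. -}

module Defs where

open import Level using (Level; _⊔_)
open import Data.Nat using (ℕ; zero; suc)
open import Data.Bool using (Bool; true; false)
import Data.Bool.Properties as BoolP
open import Data.Fin using (Fin)
open import Data.Vec using (Vec; []; _∷_; lookup; tabulate)
open import Data.Vec.Properties using (≡-dec)
open import Data.List using (List; []; _∷_; map; _++_; foldr)
open import Data.Product using (Σ; ∃; _×_; _,_)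
open import Data.Fin.Permutation using (Permutation′; _⟨$⟩ʳ_; _⟨$⟩ˡ_)
open import Relation.Nullary using (¬_; yes; no)
open import Relation.Binary.PropositionalEquality using (_≡_)
open import Algebra.Bundles using (CommutativeRing)

Subset : ℕ → Set
Subset n = Vec Bool n

powerSet : (n : ℕ) → List (Subset n)
powerSet zero = [] ∷ []
powerSet (suc n) = map (true ∷_) (powerSet n) ++ map (false ∷_) (powerSet n)

_≟S_ : ∀ {n} (A B : Subset n) → Relation.Nullary.Dec (A ≡ B)
_≟S_ = ≡-dec BoolP._≟_

-- the action π · A = π(A) : j ∈ π(A) iff π⁻¹(j) ∈ A
act : ∀ {n} → Permutation′ n → Subset n → Subset n
act π A = tabulate (λ j → lookup A (π ⟨$⟩ˡ j))

Conjugate : ∀ {n} → Permutation′ n → Permutation′ n → Set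
Conjugate {n} π σ =
  ∃ λ (τ : Permutation′ n) → ∀ i → σ ⟨$⟩ʳ i ≡ τ ⟨$⟩ʳ (π ⟨$⟩ʳ (τ ⟨$⟩ˡ i))

module _ {c ℓ : Level} (K : CommutativeRing c ℓ) where
  open CommutativeRing K

  natK : ℕ → Carrier
  natK zero = 0#
  natK (suc m) = 1# + natK m

  record IsCharZeroField : Set (c ⊔ ℓ) where
    field
      1≉0     : ¬ (1# ≈ 0#)
      inverse : ∀ x → ¬ (x ≈ 0#) → ∃ λ y → x * y ≈ 1#
      charZero : ∀ (m : ℕ) → ¬ (natK (suc m) ≈ 0#)

  Mat : ℕ → Set c
  Mat n = Subset n → Subset n → Carrier

  Σ[_] : ∀ {n} → (Subset n → Carrier) → Carrier
  Σ[_] {n} f = foldr (λ A s → f A + s) 0# (powerSet n)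

  _⊗_ : ∀ {n} → Mat n → Mat n → Mat n
  (M ⊗ N) A B = Σ[ (λ C → M A C * N C B) ]

  I : ∀ {n} → Mat n
  I A B with A ≟S B
  ... | yes _ = 1#
  ... | no _  = 0#

  _≈M_ : ∀ {n} → Mat n → Mat n → Set ℓ
  M ≈M N = ∀ A B → M A B ≈ N A B

  Similar : ∀ {n} → Mat n → Mat n → Set (c ⊔ ℓ)
  Similar {n} M N = ∃ λ (P : Mat n) → ∃ λ (Q : Mat n) →
    ((P ⊗ Q) ≈M I) × ((Q ⊗ P) ≈M I) × ((P ⊗ (M ⊗ Q)) ≈M N)

  T : ∀ {n} → Permutation′ n → Mat n
  T π B A with B ≟S act π A
  ... | yes _ = 1#
  ... | no _  = 0#

{-# OPTIONS --safe #-}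
-- Similar matrices have equal traces of all powers, and tr T(ρ) is the number of
-- ρ-invariant subsets, i.e. 2 ^ (number of cycles of ρ). In characteristic zero
-- this shows that π ^ k and σ ^ k have the same number of cycles for every k.
-- If ρ has cycles of lengths l₁, …, lᵣ then ρ ^ k has Σᵢ gcd(lᵢ, k) cycles; grouping
-- the residues j mod k by their additive order turns this into
-- Σ_{j<k} #{i | order(j) ∣ lᵢ}, from which strong induction on k recovers, for
-- every d, how many lᵢ are divisible by d, and hence the multiset of the lᵢ.
-- Permutations with the same cycle lengths are conjugate.
module Submission where

open import Level using (Level)
open import Data.Nat as Nat using (ℕ; zero; suc; _^_; _≤_; _<_; NonZero; ≢-nonZero; z≤n; s≤s)
import Data.Nat.Properties as ℕₚ
open import Data.Nat.Properties using (≤-refl; ≤-trans; ≤-reflexive; ≤-pred; ≤-total; <-cmp; +-suc; m≤n⇒∃[o]m+o≡n; m≤n+m; +-monoˡ-≤; 1+n≰n; anyUpTo?; ^-distribˡ-+-*)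
open import Data.Nat.Induction using (<-rec)
open import Data.Nat.DivMod using (m%n<n; m%n%n≡m%n; [m+n]%n≡m%n; %-distribˡ-+; m<n⇒m%n≡m; m≡m%n+[m/n]*n; m∣n⇒o%n%m≡o%m)
open import Data.Nat.Divisibility using (_∣_; divides)
open import Data.Nat.GCD using (gcd; gcd-GCD; gcd[m,n]∣m; gcd[m,n]∣n; gcd[m,n]≢0; module Bézout)
open import Data.Nat.GeneralisedArithmetic using (fold; fold-+)
open import Data.Nat.Logarithm using (⌊log₂_⌋; ⌊log₂[2^n]⌋≡n)
open import Data.Bool using (Bool; true; false; T?; _∧_; not)
import Data.Bool as Bool
open import Data.Bool.Properties using (T-irrelevant; T-∧)
open import Data.Unit using (tt)
open import Data.Empty using (⊥-elim)
open import Data.Fin using (Fin; zero; suc; toℕ; fromℕ<; splitAt; join)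
open import Data.Fin.Properties using (all?; any?; _≟_; fromℕ<-cong; toℕ-fromℕ<; fromℕ<-toℕ; toℕ<n; toℕ-injective; +↔⊎; splitAt-join; join-splitAt; pigeonhole)
open import Data.Fin.Permutation as Perm using (Permutation′; _⟨$⟩ʳ_; _⟨$⟩ˡ_; _∘ₚ_; flip; inverseˡ; inverseʳ; permutation; ↔⇒≡)
open import Data.Vec using (Vec; []; _∷_; lookup; tabulate; _++_)
open import Data.Vec.Properties using (∷-injectiveˡ; ∷-injectiveʳ; lookup∘tabulate; tabulate-cong; tabulate∘lookup; lookup-++ˡ; lookup-++ʳ)
open import Data.List using (List; []; _∷_; map; foldr)
import Data.List as List
open import Data.List.Relation.Binary.Permutation.Propositional as ↭ using (_↭_)
open import Data.Sum as Sum using (_⊎_; inj₁; inj₂)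
import Data.Sum.Properties as Sum
open import Data.Sum.Function.Propositional using (_⊎-↔_)
open import Data.Product using (Σ; ∃; _×_; _,_; proj₁; proj₂; map₂)
open import Function using (_∘_; id)
open import Function.Bundles using (Inverse; _↔_; Equivalence; mk↔ₛ′; mk⇔)
open import Function.Properties.Inverse using (↔-refl; ↔-sym; ↔-trans)
open import Relation.Nullary using (¬_; Dec; yes; no; does; _×-dec_)
open import Relation.Nullary.Decidable using (⌊_⌋; toWitness; fromWitness; isYes≗does; does-⇔; dec-true; dec-false)
open import Relation.Binary.PropositionalEquality as ≡ using (_≡_; _≢_; cong; cong₂)
open import Relation.Binary.Definitions using (tri<; tri≈; tri>)
open import Relation.Binary.Bundles using (Setoid)
import Relation.Binary.Reasoning.Setoid as SetoidReasoning
open import Algebra.Bundles using (CommutativeRing; Monoid)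
open import Defs

module PowerSetSums {c ℓ : Level} (K : CommutativeRing c ℓ) where
  open CommutativeRing K
  open import Relation.Binary.Reasoning.Setoid setoid
  open import Algebra.Properties.CommutativeSemigroup +-commutativeSemigroup using (interchange)

  natK-+ : ∀ a b → natK K (a Nat.+ b) ≈ natK K a + natK K b
  natK-+ zero    b = sym (+-identityˡ _)
  natK-+ (suc a) b = trans (+-congˡ (natK-+ a b)) (sym (+-assoc _ _ _))

  natK-* : ∀ a b → natK K (a Nat.* b) ≈ natK K a * natK K b
  natK-* zero    b = sym (zeroˡ _)
  natK-* (suc a) b = begin
    natK K (b Nat.+ a Nat.* b)             ≈⟨ natK-+ b (a Nat.* b) ⟩
    natK K b + natK K (a Nat.* b)          ≈⟨ +-cong (sym (*-identityˡ _)) (natK-* a b) ⟩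
    1# * natK K b + natK K a * natK K b    ≈⟨ distribʳ _ _ _ ⟨
    (1# + natK K a) * natK K b             ∎

  ∑ : {X : Set} → List X → (X → Carrier) → Carrier
  ∑ xs f = foldr (λ x s → f x + s) 0# xs

  module _ {X : Set} where

    ∑-cong : ∀ (xs : List X) {f g : X → Carrier} → (∀ x → f x ≈ g x) → ∑ xs f ≈ ∑ xs g
    ∑-cong []       f≈g = refl
    ∑-cong (x ∷ xs) f≈g = +-cong (f≈g x) (∑-cong xs f≈g)

    ∑-zero : ∀ (xs : List X) → ∑ xs (λ _ → 0#) ≈ 0#
    ∑-zero []       = refl
    ∑-zero (x ∷ xs) = trans (+-identityˡ _) (∑-zero xs)

    ∑-distrib-+ : ∀ (xs : List X) (f g : X → Carrier) → ∑ xs (λ x → f x + g x) ≈ ∑ xs f + ∑ xs g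
    ∑-distrib-+ []       f g = sym (+-identityˡ 0#)
    ∑-distrib-+ (x ∷ xs) f g = trans (+-congˡ (∑-distrib-+ xs f g)) (interchange (f x) (g x) _ _)

    *-distribˡ-∑ : ∀ (xs : List X) (a : Carrier) (f : X → Carrier) → a * ∑ xs f ≈ ∑ xs (λ x → a * f x)
    *-distribˡ-∑ []       a f = zeroʳ a
    *-distribˡ-∑ (x ∷ xs) a f = trans (distribˡ a (f x) _) (+-congˡ (*-distribˡ-∑ xs a f))

    *-distribʳ-∑ : ∀ (xs : List X) (a : Carrier) (f : X → Carrier) → ∑ xs f * a ≈ ∑ xs (λ x → f x * a)
    *-distribʳ-∑ xs a f = trans (*-comm _ a) (trans (*-distribˡ-∑ xs a f) (∑-cong xs (λ x → *-comm a (f x))))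

    ∑-++ : ∀ (xs ys : List X) (f : X → Carrier) → ∑ (xs List.++ ys) f ≈ ∑ xs f + ∑ ys f
    ∑-++ []       ys f = sym (+-identityˡ _)
    ∑-++ (x ∷ xs) ys f = trans (+-congˡ (∑-++ xs ys f)) (sym (+-assoc _ _ _))

    ∑-map : ∀ {Y : Set} (xs : List Y) (h : Y → X) (f : X → Carrier) → ∑ (map h xs) f ≈ ∑ xs (λ y → f (h y))
    ∑-map []       h f = refl
    ∑-map (y ∷ ys) h f = +-congˡ (∑-map ys h f)

  module _ {X Y : Set} (xs : List X) (ys : List Y) where

    ∑-comm : (f : X → Y → Carrier) → ∑ xs (λ x → ∑ ys (f x)) ≈ ∑ ys (λ y → ∑ xs (λ x → f x y))
    ∑-comm f = ∑-comm′ xs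
      where
      ∑-comm′ : ∀ xs → ∑ xs (λ x → ∑ ys (f x)) ≈ ∑ ys (λ y → ∑ xs (λ x → f x y))
      ∑-comm′ []       = sym (∑-zero ys)
      ∑-comm′ (x ∷ xs) = trans (+-congˡ (∑-comm′ xs)) (sym (∑-distrib-+ ys (f x) _))

    ∑-product : (f : X → Carrier) (g : Y → Carrier) → ∑ xs (λ x → ∑ ys (λ y → f x * g y)) ≈ ∑ xs f * ∑ ys g
    ∑-product f g = trans (∑-cong xs (λ x → sym (*-distribˡ-∑ ys (f x) g))) (sym (*-distribʳ-∑ xs (∑ ys g) f))

  ⟦_⟧ : ∀ {p} {P : Set p} → Dec P → Carrier
  ⟦ P? ⟧ = Bool.if does P? then 1# else 0#

  ⟦yes⟧ : ∀ {p} {P : Set p} (P? : Dec P) → P → ⟦ P? ⟧ ≈ 1#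
  ⟦yes⟧ P? p rewrite dec-true P? p = refl

  module _ {p q} {P : Set p} {Q : Set q} where

    ⟦⟧-cong : (P? : Dec P) (Q? : Dec Q) → (P → Q) → (Q → P) → ⟦ P? ⟧ ≈ ⟦ Q? ⟧
    ⟦⟧-cong P? Q? to from = reflexive (cong (λ b → Bool.if b then 1# else 0#) (does-⇔ (mk⇔ to from) P? Q?))

    ⟦×⟧ : (P? : Dec P) (Q? : Dec Q) → ⟦ P? ×-dec Q? ⟧ ≈ ⟦ P? ⟧ * ⟦ Q? ⟧
    ⟦×⟧ P? Q? with does P? | does Q?
    ... | true  | true  = sym (*-identityˡ 1#)
    ... | true  | false = sym (*-identityˡ 0#)
    ... | false | _     = sym (zeroˡ _)

  ⟦≟S⟧-congʳ : ∀ {n} (B : Subset n) {X Y} → X ≡ Y → ⟦ B ≟S X ⟧ ≈ ⟦ B ≟S Y ⟧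
  ⟦≟S⟧-congʳ B ≡.refl = refl

  ∑ₚ : ∀ {n} → (Subset n → Carrier) → Carrier
  ∑ₚ = Σ[_] K

  ∑ₚ-suc : ∀ n (f : Subset (suc n) → Carrier) → ∑ₚ f ≈ ∑ₚ (λ A → f (true ∷ A)) + ∑ₚ (λ A → f (false ∷ A))
  ∑ₚ-suc n f = trans (∑-++ (map (true ∷_) (powerSet n)) _ f) (+-cong (∑-map (powerSet n) _ f) (∑-map (powerSet n) _ f))

  ∑ₚ-++ : ∀ a b (f : Subset (a Nat.+ b) → Carrier) → ∑ₚ f ≈ ∑ₚ {a} (λ B → ∑ₚ {b} (λ C → f (B ++ C)))
  ∑ₚ-++ zero    b f = sym (+-identityʳ _)
  ∑ₚ-++ (suc a) b f = begin
    ∑ₚ {suc a Nat.+ b} f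
      ≈⟨ ∑ₚ-suc (a Nat.+ b) f ⟩
    ∑ₚ {a Nat.+ b} (λ A → f (true ∷ A)) + ∑ₚ {a Nat.+ b} (λ A → f (false ∷ A))
      ≈⟨ +-cong (∑ₚ-++ a b _) (∑ₚ-++ a b _) ⟩
    ∑ₚ {a} (λ B → ∑ₚ {b} (λ C → f (true ∷ B ++ C))) + ∑ₚ {a} (λ B → ∑ₚ {b} (λ C → f (false ∷ B ++ C)))
      ≈⟨ ∑ₚ-suc a _ ⟨
    ∑ₚ {suc a} (λ B → ∑ₚ {b} (λ C → f (B ++ C)))
      ∎

  ∑ₚ-const-1 : ∀ n → ∑ₚ {n} (λ _ → 1#) ≈ natK K (2 ^ n)
  ∑ₚ-const-1 zero    = refl
  ∑ₚ-const-1 (suc n) = begin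
    ∑ₚ {suc n} (λ _ → 1#)                      ≈⟨ ∑ₚ-suc n _ ⟩
    ∑ₚ {n} (λ _ → 1#) + ∑ₚ {n} (λ _ → 1#)      ≈⟨ +-cong (∑ₚ-const-1 n) (trans (∑ₚ-const-1 n) (sym (+-identityʳ _))) ⟩
    natK K (2 ^ n) + (natK K (2 ^ n) + 0#)     ≈⟨ +-congˡ (natK-+ (2 ^ n) 0) ⟨
    natK K (2 ^ n) + natK K (2 ^ n Nat.+ 0)    ≈⟨ natK-+ (2 ^ n) (2 ^ n Nat.+ 0) ⟨
    natK K (2 ^ suc n)                         ∎

  ⟦∷≟∷⟧ : ∀ {n} (a b : Bool) (A B : Subset n) → ⟦ (a ∷ A) ≟S (b ∷ B) ⟧ ≈ ⟦ a Bool.≟ b ⟧ * ⟦ A ≟S B ⟧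
  ⟦∷≟∷⟧ a b A B = trans
    (⟦⟧-cong ((a ∷ A) ≟S (b ∷ B)) (a Bool.≟ b ×-dec A ≟S B)
      (λ e → ∷-injectiveˡ e , ∷-injectiveʳ e) (λ (a≡b , A≡B) → cong₂ _∷_ a≡b A≡B))
    (⟦×⟧ (a Bool.≟ b) (A ≟S B))

  ∑ₚ-select : ∀ {n} (X : Subset n) (h : Subset n → Carrier) → ∑ₚ (λ A → ⟦ A ≟S X ⟧ * h A) ≈ h X
  ∑ₚ-select []      h = trans (+-identityʳ _) (trans (*-congʳ (⟦yes⟧ ([] ≟S []) ≡.refl)) (*-identityˡ _))
  ∑ₚ-select {suc n} (b ∷ X) h = begin
    ∑ₚ (λ A → ⟦ A ≟S (b ∷ X) ⟧ * h A)
      ≈⟨ ∑ₚ-suc n _ ⟩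
    ∑ₚ {n} (λ A → ⟦ (true ∷ A) ≟S (b ∷ X) ⟧ * h (true ∷ A)) + ∑ₚ (λ A → ⟦ (false ∷ A) ≟S (b ∷ X) ⟧ * h (false ∷ A))
      ≈⟨ +-cong (select-∷ true) (select-∷ false) ⟩
    ⟦ true Bool.≟ b ⟧ * h (true ∷ X) + ⟦ false Bool.≟ b ⟧ * h (false ∷ X)
      ≈⟨ select-Bool b ⟩
    h (b ∷ X)
      ∎
    where
    select-∷ : ∀ a → ∑ₚ (λ A → ⟦ (a ∷ A) ≟S (b ∷ X) ⟧ * h (a ∷ A)) ≈ ⟦ a Bool.≟ b ⟧ * h (a ∷ X)
    select-∷ a = begin
      ∑ₚ (λ A → ⟦ (a ∷ A) ≟S (b ∷ X) ⟧ * h (a ∷ A))              ≈⟨ ∑-cong (powerSet n) (λ A → trans (*-congʳ (⟦∷≟∷⟧ a b A X)) (*-assoc _ _ _)) ⟩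
      ∑ₚ {n} (λ A → ⟦ a Bool.≟ b ⟧ * (⟦ A ≟S X ⟧ * h (a ∷ A)))    ≈⟨ *-distribˡ-∑ (powerSet n) _ _ ⟨
      ⟦ a Bool.≟ b ⟧ * ∑ₚ {n} (λ A → ⟦ A ≟S X ⟧ * h (a ∷ A))      ≈⟨ *-congˡ (∑ₚ-select X (λ A → h (a ∷ A))) ⟩
      ⟦ a Bool.≟ b ⟧ * h (a ∷ X)                                  ∎
    select-Bool : ∀ b → ⟦ true Bool.≟ b ⟧ * h (true ∷ X) + ⟦ false Bool.≟ b ⟧ * h (false ∷ X) ≈ h (b ∷ X)
    select-Bool true  = trans (+-cong (*-identityˡ _) (zeroˡ _)) (+-identityʳ _)
    select-Bool false = trans (+-cong (zeroˡ _) (*-identityˡ _)) (+-identityˡ _)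

  ∑ₚ-selectˡ : ∀ {n} (X : Subset n) (h : Subset n → Carrier) → ∑ₚ (λ A → ⟦ X ≟S A ⟧ * h A) ≈ h X
  ∑ₚ-selectˡ X h = trans (∑-cong (powerSet _) (λ A → *-congʳ (⟦⟧-cong (X ≟S A) (A ≟S X) ≡.sym ≡.sym))) (∑ₚ-select X h)

  ∑ₚ-retract : ∀ {g l} (r : Subset g → Subset l) (s : Subset l → Subset g) → (∀ C → s (r C) ≡ C) →
               ∑ₚ (λ B → ⟦ B ≟S r (s B) ⟧) ≈ natK K (2 ^ g)
  ∑ₚ-retract {g} {l} r s s∘r≗id = begin
    ∑ₚ (λ B → ⟦ B ≟S r (s B) ⟧)                          ≈⟨ ∑-cong (powerSet l) (λ B → ∑ₚ-select (s B) (λ C → ⟦ B ≟S r C ⟧)) ⟨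
    ∑ₚ (λ B → ∑ₚ (λ C → ⟦ C ≟S s B ⟧ * ⟦ B ≟S r C ⟧))    ≈⟨ ∑-comm (powerSet l) (powerSet g) _ ⟩
    ∑ₚ (λ C → ∑ₚ (λ B → ⟦ C ≟S s B ⟧ * ⟦ B ≟S r C ⟧))    ≈⟨ ∑-cong (powerSet g) (λ C → ∑-cong (powerSet l) (λ B → *-comm _ _)) ⟩
    ∑ₚ (λ C → ∑ₚ (λ B → ⟦ B ≟S r C ⟧ * ⟦ C ≟S s B ⟧))    ≈⟨ ∑-cong (powerSet g) (λ C → ∑ₚ-select (r C) (λ B → ⟦ C ≟S s B ⟧)) ⟩
    ∑ₚ (λ C → ⟦ C ≟S s (r C) ⟧)                          ≈⟨ ∑-cong (powerSet g) (λ C → ⟦yes⟧ (C ≟S s (r C)) (≡.sym (s∘r≗id C))) ⟩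
    ∑ₚ {g} (λ _ → 1#)                                    ≈⟨ ∑ₚ-const-1 g ⟩
    natK K (2 ^ g)                                       ∎

module Matrices {c ℓ : Level} (K : CommutativeRing c ℓ) where
  open CommutativeRing K
  open PowerSetSums K

  infixl 7 _⊛_
  infix 4 _≋_

  _⊛_ : ∀ {n} → Mat K n → Mat K n → Mat K n
  _⊛_ = _⊗_ K

  _≋_ : ∀ {n} → Mat K n → Mat K n → Set ℓ
  _≋_ = _≈M_ K

  𝟙 : ∀ {n} → Mat K n
  𝟙 = I K

  ≋-setoid : ℕ → Setoid c ℓ
  ≋-setoid n = record
    { Carrier       = Mat K n
    ; _≈_           = _≋_
    ; isEquivalence = record
      { refl  = λ _ _ → refl
      ; sym   = λ M≋N A B → sym (M≋N A B)
      ; trans = λ M≋N N≋P A B → trans (M≋N A B) (N≋P A B)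
      }
    }

  module ≋-Reasoning {n} = SetoidReasoning (≋-setoid n)

  module _ {n : ℕ} where

    ⊛-cong : {M M′ N N′ : Mat K n} → M ≋ M′ → N ≋ N′ → M ⊛ N ≋ M′ ⊛ N′
    ⊛-cong M≋M′ N≋N′ A B = ∑-cong (powerSet n) (λ C → *-cong (M≋M′ A C) (N≋N′ C B))

    ⊛-congˡ : {M N N′ : Mat K n} → N ≋ N′ → M ⊛ N ≋ M ⊛ N′
    ⊛-congˡ = ⊛-cong (λ _ _ → refl)

    ⊛-congʳ : {M M′ N : Mat K n} → M ≋ M′ → M ⊛ N ≋ M′ ⊛ N
    ⊛-congʳ M≋M′ = ⊛-cong M≋M′ (λ _ _ → refl)

    ⊛-assoc : (M N P : Mat K n) → (M ⊛ N) ⊛ P ≋ M ⊛ (N ⊛ P)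
    ⊛-assoc M N P A B = begin
      ∑ₚ (λ C → ∑ₚ (λ D → M A D * N D C) * P C B)   ≈⟨ ∑-cong (powerSet n) (λ C → *-distribʳ-∑ (powerSet n) (P C B) _) ⟩
      ∑ₚ (λ C → ∑ₚ (λ D → M A D * N D C * P C B))   ≈⟨ ∑-comm (powerSet n) (powerSet n) _ ⟩
      ∑ₚ (λ D → ∑ₚ (λ C → M A D * N D C * P C B))   ≈⟨ ∑-cong (powerSet n) (λ D → ∑-cong (powerSet n) (λ C → *-assoc _ _ _)) ⟩
      ∑ₚ (λ D → ∑ₚ (λ C → M A D * (N D C * P C B))) ≈⟨ ∑-cong (powerSet n) (λ D → *-distribˡ-∑ (powerSet n) (M A D) _) ⟨
      ∑ₚ (λ D → M A D * ∑ₚ (λ C → N D C * P C B))   ∎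
      where open SetoidReasoning setoid

    𝟙≈⟦≟⟧ : (A B : Subset n) → 𝟙 A B ≈ ⟦ A ≟S B ⟧
    𝟙≈⟦≟⟧ A B with A ≟S B
    ... | yes _ = refl
    ... | no  _ = refl

    ⊛-identityˡ : (M : Mat K n) → 𝟙 ⊛ M ≋ M
    ⊛-identityˡ M A B = trans (∑-cong (powerSet n) (λ C → *-congʳ (𝟙≈⟦≟⟧ A C))) (∑ₚ-selectˡ A (λ C → M C B))

    ⊛-identityʳ : (M : Mat K n) → M ⊛ 𝟙 ≋ M
    ⊛-identityʳ M A B = trans (∑-cong (powerSet n) (λ C → trans (*-comm _ _) (*-congʳ (𝟙≈⟦≟⟧ C B)))) (∑ₚ-select B (λ C → M A C))

    tr : Mat K n → Carrier
    tr M = ∑ₚ (λ A → M A A)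

    tr-cong : {M N : Mat K n} → M ≋ N → tr M ≈ tr N
    tr-cong M≋N = ∑-cong (powerSet n) (λ A → M≋N A A)

    tr-comm : (M N : Mat K n) → tr (M ⊛ N) ≈ tr (N ⊛ M)
    tr-comm M N = trans (∑-comm (powerSet n) (powerSet n) _) (∑-cong (powerSet n) (λ C → ∑-cong (powerSet n) (λ A → *-comm _ _)))

    infixr 8 _⊛^_
    _⊛^_ : Mat K n → ℕ → Mat K n
    M ⊛^ zero  = 𝟙
    M ⊛^ suc k = M ⊛ M ⊛^ k

    ⊛-monoid : Monoid c ℓ
    ⊛-monoid = record
      { Carrier  = Mat K n
      ; _≈_      = _≋_
      ; _∙_      = _⊛_
      ; ε        = 𝟙
      ; isMonoid = record
        { isSemigroup = record
          { isMagma = record { isEquivalence = Setoid.isEquivalence (≋-setoid n) ; ∙-cong = ⊛-cong }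
          ; assoc   = ⊛-assoc
          }
        ; identity = ⊛-identityˡ , ⊛-identityʳ
        }
      }

  module _ {n : ℕ} {P Q : Mat K n} (PQ≋𝟙 : P ⊛ Q ≋ 𝟙) (QP≋𝟙 : Q ⊛ P ≋ 𝟙) where
    open import Algebra.Solver.Monoid (⊛-monoid {n}) using (solve; _⊜_; _⊕_)

    conj : Mat K n → Mat K n
    conj X = P ⊛ (X ⊛ Q)

    conj-⊛ : (X Y : Mat K n) → conj (X ⊛ Y) ≋ conj X ⊛ conj Y
    conj-⊛ X Y = begin
      P ⊛ ((X ⊛ Y) ⊛ Q)                ≈⟨ ⊛-congˡ (⊛-congʳ (⊛-congʳ (⊛-identityʳ X))) ⟨
      P ⊛ (((X ⊛ 𝟙) ⊛ Y) ⊛ Q)          ≈⟨ ⊛-congˡ (⊛-congʳ (⊛-congʳ (⊛-congˡ QP≋𝟙))) ⟨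
      P ⊛ (((X ⊛ (Q ⊛ P)) ⊛ Y) ⊛ Q)    ≈⟨ solve 4 (λ p q x y → p ⊕ (((x ⊕ (q ⊕ p)) ⊕ y) ⊕ q) ⊜ (p ⊕ (x ⊕ q)) ⊕ (p ⊕ (y ⊕ q)))
                                              (Setoid.refl (≋-setoid n)) P Q X Y ⟩
      (P ⊛ (X ⊛ Q)) ⊛ (P ⊛ (Y ⊛ Q))    ∎
      where open ≋-Reasoning

    conj-⊛^ : {M N : Mat K n} → conj M ≋ N → ∀ k → conj (M ⊛^ k) ≋ N ⊛^ k
    conj-⊛^ {M} {N} PMQ≋N zero    = begin
      P ⊛ (𝟙 ⊛ Q)  ≈⟨ ⊛-congˡ (⊛-identityˡ Q) ⟩
      P ⊛ Q        ≈⟨ PQ≋𝟙 ⟩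
      𝟙            ∎
      where open ≋-Reasoning
    conj-⊛^ {M} {N} PMQ≋N (suc k) = begin
      conj (M ⊛ M ⊛^ k)          ≈⟨ conj-⊛ M (M ⊛^ k) ⟩
      conj M ⊛ conj (M ⊛^ k)     ≈⟨ ⊛-cong PMQ≋N (conj-⊛^ PMQ≋N k) ⟩
      N ⊛ N ⊛^ k                 ∎
      where open ≋-Reasoning

    tr-conj : (X : Mat K n) → tr (conj X) ≈ tr X
    tr-conj X = begin
      tr (P ⊛ (X ⊛ Q))  ≈⟨ tr-comm P (X ⊛ Q) ⟩
      tr ((X ⊛ Q) ⊛ P)  ≈⟨ tr-cong (⊛-assoc X Q P) ⟩
      tr (X ⊛ (Q ⊛ P))  ≈⟨ tr-cong (⊛-congˡ QP≋𝟙) ⟩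
      tr (X ⊛ 𝟙)        ≈⟨ tr-cong (⊛-identityʳ X) ⟩
      tr X              ∎
      where open SetoidReasoning setoid

  tr-⊛^-similar : ∀ {n} {M N : Mat K n} → Similar K M N → ∀ k → tr (M ⊛^ k) ≈ tr (N ⊛^ k)
  tr-⊛^-similar {M = M} (P , Q , PQ≋𝟙 , QP≋𝟙 , PMQ≋N) k =
    trans (sym (tr-conj PQ≋𝟙 QP≋𝟙 (M ⊛^ k))) (tr-cong (conj-⊛^ PQ≋𝟙 QP≋𝟙 PMQ≋N k))

-- The permutation representation

infixl 10 _^ₚ_

_^ₚ_ : ∀ {n} → Permutation′ n → ℕ → Permutation′ n
ρ ^ₚ zero  = Perm.id
ρ ^ₚ suc k = ρ ^ₚ k ∘ₚ ρ

≈⇒≈ˡ : ∀ {n} (π ρ : Permutation′ n) → π Perm.≈ ρ → ∀ j → π ⟨$⟩ˡ j ≡ ρ ⟨$⟩ˡ j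
≈⇒≈ˡ π ρ π≈ρ j = begin
  π ⟨$⟩ˡ j                      ≡⟨ cong (π ⟨$⟩ˡ_) (inverseʳ ρ) ⟨
  π ⟨$⟩ˡ (ρ ⟨$⟩ʳ (ρ ⟨$⟩ˡ j))    ≡⟨ cong (π ⟨$⟩ˡ_) (π≈ρ (ρ ⟨$⟩ˡ j)) ⟨
  π ⟨$⟩ˡ (π ⟨$⟩ʳ (ρ ⟨$⟩ˡ j))    ≡⟨ inverseˡ π ⟩
  ρ ⟨$⟩ˡ j                      ∎
  where open ≡.≡-Reasoning

act-∘ₚ : ∀ {n} (ρ ρ′ : Permutation′ n) (A : Subset n) → act ρ (act ρ′ A) ≡ act (ρ′ ∘ₚ ρ) A
act-∘ₚ ρ ρ′ A = tabulate-cong (λ j → lookup∘tabulate _ (ρ ⟨$⟩ˡ j))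

act-cong : ∀ {n} (ρ ρ′ : Permutation′ n) → ρ Perm.≈ ρ′ → ∀ A → act ρ A ≡ act ρ′ A
act-cong ρ ρ′ ρ≈ρ′ A = tabulate-cong (λ j → cong (lookup A) (≈⇒≈ˡ ρ ρ′ ρ≈ρ′ j))

act-id : ∀ {n} (A : Subset n) → act Perm.id A ≡ A
act-id = tabulate∘lookup

Invariant : ∀ {n} → (Fin n → Fin n) → Subset n → Set
Invariant f A = ∀ j → lookup A (f j) ≡ lookup A j

invariant? : ∀ {n} (f : Fin n → Fin n) (A : Subset n) → Dec (Invariant f A)
invariant? f A = all? (λ j → lookup A (f j) Bool.≟ lookup A j)

Invariant-cong : ∀ {n} {f g : Fin n → Fin n} → (∀ j → f j ≡ g j) → ∀ A → Invariant f A → Invariant g A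
Invariant-cong f≗g A inv j = ≡.trans (cong (lookup A) (≡.sym (f≗g j))) (inv j)

fixed⇒Invariant : ∀ {n} (ρ : Permutation′ n) A → A ≡ act ρ A → Invariant (ρ ⟨$⟩ʳ_) A
fixed⇒Invariant ρ A A≡ρA j = begin
  lookup A (ρ ⟨$⟩ʳ j)                ≡⟨ cong (λ X → lookup X (ρ ⟨$⟩ʳ j)) A≡ρA ⟩
  lookup (act ρ A) (ρ ⟨$⟩ʳ j)        ≡⟨ lookup∘tabulate _ (ρ ⟨$⟩ʳ j) ⟩
  lookup A (ρ ⟨$⟩ˡ (ρ ⟨$⟩ʳ j))        ≡⟨ cong (lookup A) (inverseˡ ρ) ⟩
  lookup A j                         ∎
  where open ≡.≡-Reasoning

Invariant⇒fixed : ∀ {n} (ρ : Permutation′ n) A → Invariant (ρ ⟨$⟩ʳ_) A → A ≡ act ρ A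
Invariant⇒fixed ρ A inv = ≡.trans (≡.sym (tabulate∘lookup A))
  (tabulate-cong (λ j → ≡.trans (cong (lookup A) (≡.sym (inverseʳ ρ))) (inv (ρ ⟨$⟩ˡ j))))

module PermutationRepresentation {c ℓ : Level} (K : CommutativeRing c ℓ) where
  open CommutativeRing K
  open PowerSetSums K
  open Matrices K

  T≈⟦⟧ : ∀ {n} (ρ : Permutation′ n) (B A : Subset n) → T K ρ B A ≈ ⟦ B ≟S act ρ A ⟧
  T≈⟦⟧ ρ B A with B ≟S act ρ A
  ... | yes _ = refl
  ... | no  _ = refl

  T-cong : ∀ {n} (ρ ρ′ : Permutation′ n) → ρ Perm.≈ ρ′ → T K ρ ≋ T K ρ′
  T-cong ρ ρ′ ρ≈ρ′ B A = trans (T≈⟦⟧ ρ B A) (trans (⟦≟S⟧-congʳ B (act-cong ρ ρ′ ρ≈ρ′ A)) (sym (T≈⟦⟧ ρ′ B A)))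

  T-id : ∀ {n} → T K (Perm.id {n}) ≋ 𝟙
  T-id B A = trans (T≈⟦⟧ Perm.id B A) (trans (⟦≟S⟧-congʳ B (act-id A)) (sym (𝟙≈⟦≟⟧ B A)))

  T-∘ₚ : ∀ {n} (ρ ρ′ : Permutation′ n) → T K ρ ⊛ T K ρ′ ≋ T K (ρ′ ∘ₚ ρ)
  T-∘ₚ {n} ρ ρ′ B A = begin
    ∑ₚ (λ C → T K ρ B C * T K ρ′ C A)                ≈⟨ ∑-cong (powerSet n) (λ C → trans (*-cong (T≈⟦⟧ ρ B C) (T≈⟦⟧ ρ′ C A)) (*-comm _ _)) ⟩
    ∑ₚ (λ C → ⟦ C ≟S act ρ′ A ⟧ * ⟦ B ≟S act ρ C ⟧)  ≈⟨ ∑ₚ-select (act ρ′ A) (λ C → ⟦ B ≟S act ρ C ⟧) ⟩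
    ⟦ B ≟S act ρ (act ρ′ A) ⟧                        ≈⟨ ⟦≟S⟧-congʳ B (act-∘ₚ ρ ρ′ A) ⟩
    ⟦ B ≟S act (ρ′ ∘ₚ ρ) A ⟧                         ≈⟨ T≈⟦⟧ (ρ′ ∘ₚ ρ) B A ⟨
    T K (ρ′ ∘ₚ ρ) B A                                ∎
    where open import Relation.Binary.Reasoning.Setoid setoid

  T-⊛^ : ∀ {n} (ρ : Permutation′ n) k → T K ρ ⊛^ k ≋ T K (ρ ^ₚ k)
  T-⊛^ ρ zero    B A = sym (T-id B A)
  T-⊛^ ρ (suc k) B A = trans (⊛-congˡ {M = T K ρ} (T-⊛^ ρ k) B A) (T-∘ₚ ρ (ρ ^ₚ k) B A)

  T-inverse : ∀ {n} (τ : Permutation′ n) → T K τ ⊛ T K (flip τ) ≋ 𝟙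
  T-inverse τ B A = trans (T-∘ₚ τ (flip τ) B A) (trans (T-cong (flip τ ∘ₚ τ) Perm.id (λ _ → inverseʳ τ) B A) (T-id B A))

  Conjugate⇒Similar : ∀ {n} {π σ : Permutation′ n} → Conjugate π σ → Similar K (T K π) (T K σ)
  Conjugate⇒Similar {π = π} {σ} (τ , σ≈τπτ⁻¹) = T K τ , T K (flip τ) , T-inverse τ , T-inverse (flip τ) , τπτ⁻¹≋σ
    where
    τπτ⁻¹≋σ : T K τ ⊛ (T K π ⊛ T K (flip τ)) ≋ T K σ
    τπτ⁻¹≋σ B A = trans (⊛-congˡ {M = T K τ} (T-∘ₚ π (flip τ)) B A)
                   (trans (T-∘ₚ τ (flip τ ∘ₚ π) B A) (T-cong ((flip τ ∘ₚ π) ∘ₚ τ) σ (λ i → ≡.sym (σ≈τπτ⁻¹ i)) B A))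

  tr-T : ∀ {n} (ρ : Permutation′ n) → tr (T K ρ) ≈ ∑ₚ (λ A → ⟦ invariant? (ρ ⟨$⟩ʳ_) A ⟧)
  tr-T {n} ρ = ∑-cong (powerSet n) (λ A → trans (T≈⟦⟧ ρ A A)
    (⟦⟧-cong (A ≟S act ρ A) (invariant? _ A) (fixed⇒Invariant ρ A) (Invariant⇒fixed ρ A)))

-- Rotations and periodic subsets

[m%n+o]%n≡[m+o]%n : ∀ m n o .{{_ : NonZero n}} → (m Nat.% n Nat.+ o) Nat.% n ≡ (m Nat.+ o) Nat.% n
[m%n+o]%n≡[m+o]%n m n o = begin
  (m % n + o) % n            ≡⟨ %-distribˡ-+ (m % n) o n ⟩
  (m % n % n + o % n) % n    ≡⟨ cong (λ w → (w + o % n) % n) (m%n%n≡m%n m n) ⟩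
  (m % n + o % n) % n        ≡⟨ %-distribˡ-+ m o n ⟨
  (m + o) % n                ∎
  where open Nat using (_+_; _%_)
        open ≡.≡-Reasoning

module Rotation (m : ℕ) where
  open Nat using (_+_; _%_)
  open ≡.≡-Reasoning

  rotate : ℕ → Fin (suc m) → Fin (suc m)
  rotate k i = fromℕ< (m%n<n (toℕ i + k) (suc m))

  toℕ-rotate : ∀ k i → toℕ (rotate k i) ≡ (toℕ i + k) % suc m
  toℕ-rotate k i = toℕ-fromℕ< (m%n<n (toℕ i + k) (suc m))

  rotate-∘ : ∀ a b i → rotate a (rotate b i) ≡ rotate (b + a) i
  rotate-∘ a b i = toℕ-injective (begin
    toℕ (rotate a (rotate b i))             ≡⟨ toℕ-rotate a (rotate b i) ⟩
    (toℕ (rotate b i) + a) % l              ≡⟨ cong (λ w → (w + a) % l) (toℕ-rotate b i) ⟩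
    ((toℕ i + b) % l + a) % l               ≡⟨ [m%n+o]%n≡[m+o]%n (toℕ i + b) l a ⟩
    (toℕ i + b + a) % l                     ≡⟨ cong (_% l) (ℕₚ.+-assoc (toℕ i) b a) ⟩
    (toℕ i + (b + a)) % l                   ≡⟨ toℕ-rotate (b + a) i ⟨
    toℕ (rotate (b + a) i)                  ∎)
    where l = suc m

  rotate-0 : ∀ i → rotate 0 i ≡ i
  rotate-0 i = toℕ-injective (≡.trans (toℕ-rotate 0 i)
    (≡.trans (cong (_% suc m) (ℕₚ.+-identityʳ (toℕ i))) (m<n⇒m%n≡m (toℕ<n i))))

  rotate-full : ∀ i → rotate (suc m) i ≡ i
  rotate-full i = toℕ-injective (≡.trans (toℕ-rotate (suc m) i)
    (≡.trans ([m+n]%n≡m%n (toℕ i) (suc m)) (m<n⇒m%n≡m (toℕ<n i))))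

module Periodicity where
  open Nat using (_+_; _*_; _%_; _/_)
  open ≡.≡-Reasoning

  Periodic : ∀ {A : Set} → ℕ → (ℕ → A) → Set
  Periodic p h = ∀ z → h (z + p) ≡ h z

  module _ {A : Set} {h : ℕ → A} where

    periodic-multiple : ∀ {p} → Periodic p h → ∀ t z → h (z + t * p) ≡ h z
    periodic-multiple per zero    z = cong h (ℕₚ.+-identityʳ z)
    periodic-multiple {p} per (suc t) z = begin
      h (z + (p + t * p))  ≡⟨ cong h (≡.trans (cong (z +_) (ℕₚ.+-comm p (t * p))) (≡.sym (ℕₚ.+-assoc z (t * p) p))) ⟩
      h (z + t * p + p)    ≡⟨ per _ ⟩
      h (z + t * p)        ≡⟨ periodic-multiple per t z ⟩
      h z                  ∎

    periodic-% : ∀ {p} .{{_ : NonZero p}} → Periodic p h → ∀ x → h (x % p) ≡ h x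
    periodic-% {p} per x = ≡.sym (≡.trans (cong h (m≡m%n+[m/n]*n x p)) (periodic-multiple per (x / p) (x % p)))

    periodic-∣ : ∀ {p q} → p ∣ q → Periodic p h → Periodic q h
    periodic-∣ (divides t ≡.refl) per z = periodic-multiple per t z

    periodic-gcd : ∀ {a b} → Periodic a h → Periodic b h → Periodic (gcd a b) h
    periodic-gcd {a} {b} per-a per-b z with Bézout.identity (gcd-GCD a b)
    ... | Bézout.+- x y eq = begin
      h (z + gcd a b)              ≡⟨ periodic-multiple per-b y (z + gcd a b) ⟨
      h (z + gcd a b + y * b)      ≡⟨ cong h (≡.trans (ℕₚ.+-assoc z _ _) (cong (z +_) eq)) ⟩
      h (z + x * a)                ≡⟨ periodic-multiple per-a x z ⟩
      h z                          ∎
    ... | Bézout.-+ x y eq = begin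
      h (z + gcd a b)              ≡⟨ periodic-multiple per-a x (z + gcd a b) ⟨
      h (z + gcd a b + x * a)      ≡⟨ cong h (≡.trans (ℕₚ.+-assoc z _ _) (cong (z +_) eq)) ⟩
      h (z + y * b)                ≡⟨ periodic-multiple per-b y z ⟩
      h z                          ∎

  cycle : ∀ {A : Set} {d} .{{_ : NonZero d}} → Vec A d → ℕ → A
  cycle {d = d} B x = lookup B (fromℕ< (m%n<n x d))

  module _ {A : Set} {d} .{{_ : NonZero d}} (B : Vec A d) where

    cycle-% : ∀ x y → x % d ≡ y % d → cycle B x ≡ cycle B y
    cycle-% x y x≡y = cong (lookup B) (fromℕ<-cong _ _ x≡y (m%n<n x d) (m%n<n y d))

    cycle-toℕ : ∀ i → cycle B (toℕ i) ≡ lookup B i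
    cycle-toℕ i = cong (lookup B)
      (≡.trans (fromℕ<-cong _ _ (m<n⇒m%n≡m (toℕ<n i)) (m%n<n (toℕ i) d) (toℕ<n i)) (fromℕ<-toℕ i (toℕ<n i)))

    periodic-cycle : Periodic d (cycle B)
    periodic-cycle z = cycle-% (z + d) z ([m+n]%n≡m%n z d)

  module Unfolding {g l} .{{_ : NonZero g}} .{{_ : NonZero l}} (g∣l : g ∣ l) {A : Set} where

    prefix : Vec A l → Vec A g
    prefix B = tabulate (λ j → cycle B (toℕ j))

    unfold : Vec A g → Vec A l
    unfold C = tabulate (λ i → cycle C (toℕ i))

    cycle-unfold : ∀ C x → cycle (unfold C) x ≡ cycle C x
    cycle-unfold C x = begin
      lookup (unfold C) (fromℕ< (m%n<n x l))   ≡⟨ lookup∘tabulate _ (fromℕ< (m%n<n x l)) ⟩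
      cycle C (toℕ (fromℕ< (m%n<n x l)))       ≡⟨ cong (cycle C) (toℕ-fromℕ< (m%n<n x l)) ⟩
      cycle C (x % l)                          ≡⟨ cycle-% C (x % l) x (m∣n⇒o%n%m≡o%m g l x g∣l) ⟩
      cycle C x                                ∎

    prefix-unfold : ∀ C → prefix (unfold C) ≡ C
    prefix-unfold C = ≡.trans (tabulate-cong (λ j → ≡.trans (cycle-unfold C (toℕ j)) (cycle-toℕ C j))) (tabulate∘lookup C)

    periodic⇒unfold : ∀ B → Periodic g (cycle B) → B ≡ unfold (prefix B)
    periodic⇒unfold B per = ≡.trans (≡.sym (tabulate∘lookup B)) (tabulate-cong λ i → begin
      lookup B i                                           ≡⟨ cycle-toℕ B i ⟨
      cycle B (toℕ i)                                      ≡⟨ periodic-% per (toℕ i) ⟨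
      cycle B (toℕ i % g)                                  ≡⟨ cong (cycle B) (toℕ-fromℕ< (m%n<n (toℕ i) g)) ⟨
      cycle B (toℕ (fromℕ< (m%n<n (toℕ i) g)))             ≡⟨ lookup∘tabulate _ (fromℕ< (m%n<n (toℕ i) g)) ⟨
      lookup (prefix B) (fromℕ< (m%n<n (toℕ i) g))       ∎)

    unfold⇒periodic : ∀ B → B ≡ unfold (prefix B) → Periodic g (cycle B)
    unfold⇒periodic B B≡ z = begin
      cycle B (z + g)                      ≡⟨ cong (λ X → cycle X (z + g)) B≡ ⟩
      cycle (unfold (prefix B)) (z + g)  ≡⟨ cycle-unfold (prefix B) (z + g) ⟩
      cycle (prefix B) (z + g)           ≡⟨ periodic-cycle (prefix B) z ⟩
      cycle (prefix B) z                 ≡⟨ cycle-unfold (prefix B) z ⟨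
      cycle (unfold (prefix B)) z        ≡⟨ cong (λ X → cycle X z) B≡ ⟨
      cycle B z                            ∎

module RotationInvariants (m : ℕ) where
  open Nat using (_+_; _%_)
  open Rotation m
  open Periodicity

  invariant⇒periodic : ∀ k B → Invariant (rotate k) B → Periodic k (cycle B)
  invariant⇒periodic k B inv z = ≡.trans (cycle-% B (z + k) (toℕ i + k) (begin
    (z + k) % suc m            ≡⟨ [m%n+o]%n≡[m+o]%n z (suc m) k ⟨
    (z % suc m + k) % suc m    ≡⟨ cong (λ w → (w + k) % suc m) (toℕ-fromℕ< (m%n<n z (suc m))) ⟨
    (toℕ i + k) % suc m        ∎)) (inv i)
    where
    open ≡.≡-Reasoning
    i = fromℕ< (m%n<n z (suc m))

  periodic⇒invariant : ∀ k B → Periodic k (cycle B) → Invariant (rotate k) B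
  periodic⇒invariant k B per i = ≡.trans (per (toℕ i)) (cycle-toℕ B i)

  module _ {c ℓ : Level} (K : CommutativeRing c ℓ) where
    open CommutativeRing K using (_≈_; trans)
    open PowerSetSums K

    -- A subset invariant under rotation by k is periodic with periods k and suc m, hence with
    -- period gcd (suc m) k, so it is the unfolding of its first gcd (suc m) k entries.
    ∑ₚ-invariant-rotate : ∀ k → ∑ₚ (λ B → ⟦ invariant? (rotate k) B ⟧) ≈ natK K (2 ^ gcd (suc m) k)
    ∑ₚ-invariant-rotate k = trans
      (∑-cong (powerSet (suc m)) λ B → ⟦⟧-cong (invariant? (rotate k) B) (B ≟S unfold (prefix B))
        (λ inv → periodic⇒unfold B (periodic-gcd (periodic-cycle B) (invariant⇒periodic k B inv)))
        (λ B≡ → periodic⇒invariant k B (periodic-∣ (gcd[m,n]∣n (suc m) k) (unfold⇒periodic B B≡))))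
      (∑ₚ-retract unfold prefix prefix-unfold)
      where
      instance
        gcd≢0 : NonZero (gcd (suc m) k)
        gcd≢0 = ≢-nonZero (gcd[m,n]≢0 (suc m) k (inj₁ (λ ())))
      open Unfolding (gcd[m,n]∣m (suc m) k)

-- Conjugacy of self-maps and permutations of a given cycle type

record _≅_ {X Y : Set} (f : X → X) (g : Y → Y) : Set where
  field
    bijection : X ↔ Y
  open Inverse bijection public using (to; from; strictlyInverseˡ; strictlyInverseʳ)
  field
    commutes : ∀ x → to (f x) ≡ g (to x)

open _≅_

≅-refl : ∀ {X : Set} (f : X → X) → f ≅ f
≅-refl f = record { bijection = ↔-refl ; commutes = λ _ → ≡.refl }

≅-sym : ∀ {X Y : Set} {f : X → X} {g : Y → Y} → f ≅ g → g ≅ f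
≅-sym {f = f} {g} f≅g = record { bijection = ↔-sym (bijection f≅g) ; commutes = commutes⁻¹ }
  where
  open ≡.≡-Reasoning
  commutes⁻¹ : ∀ y → from f≅g (g y) ≡ f (from f≅g y)
  commutes⁻¹ y = begin
    from f≅g (g y)                              ≡⟨ cong (from f≅g ∘ g) (strictlyInverseˡ f≅g y) ⟨
    from f≅g (g (to f≅g (from f≅g y)))          ≡⟨ cong (from f≅g) (commutes f≅g (from f≅g y)) ⟨
    from f≅g (to f≅g (f (from f≅g y)))          ≡⟨ strictlyInverseʳ f≅g _ ⟩
    f (from f≅g y)                              ∎

≅-trans : ∀ {X Y Z : Set} {f : X → X} {g : Y → Y} {h : Z → Z} → f ≅ g → g ≅ h → f ≅ h
≅-trans f≅g g≅h = record
  { bijection = ↔-trans (bijection f≅g) (bijection g≅h)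
  ; commutes  = λ x → ≡.trans (cong (to g≅h) (commutes f≅g x)) (commutes g≅h (to f≅g x))
  }

_⊎-≅_ : ∀ {X₁ X₂ Y₁ Y₂ : Set} {f₁ : X₁ → X₁} {f₂ : X₂ → X₂} {g₁ : Y₁ → Y₁} {g₂ : Y₂ → Y₂} →
        f₁ ≅ g₁ → f₂ ≅ g₂ → Sum.map f₁ f₂ ≅ Sum.map g₁ g₂
f₁≅g₁ ⊎-≅ f₂≅g₂ = record
  { bijection = bijection f₁≅g₁ ⊎-↔ bijection f₂≅g₂
  ; commutes  = λ { (inj₁ x) → cong inj₁ (commutes f₁≅g₁ x) ; (inj₂ x) → cong inj₂ (commutes f₂≅g₂ x) }
  }

⊎-swapˡ-≅ : ∀ {A B C : Set} (f : A → A) (g : B → B) (h : C → C) → Sum.map f (Sum.map g h) ≅ Sum.map g (Sum.map f h)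
⊎-swapˡ-≅ {A} {B} {C} f g h = record { bijection = mk↔ₛ′ swapˡ swapˡ involutive involutive ; commutes = swapˡ-commutes }
  where
  swapˡ : ∀ {X Y} → X ⊎ (Y ⊎ C) → Y ⊎ (X ⊎ C)
  swapˡ (inj₁ a)        = inj₂ (inj₁ a)
  swapˡ (inj₂ (inj₁ b)) = inj₁ b
  swapˡ (inj₂ (inj₂ c)) = inj₂ (inj₂ c)
  involutive : ∀ {X Y} (z : X ⊎ (Y ⊎ C)) → swapˡ (swapˡ z) ≡ z
  involutive (inj₁ _)        = ≡.refl
  involutive (inj₂ (inj₁ _)) = ≡.refl
  involutive (inj₂ (inj₂ _)) = ≡.refl
  swapˡ-commutes : ∀ z → swapˡ (Sum.map f (Sum.map g h) z) ≡ Sum.map g (Sum.map f h) (swapˡ z)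
  swapˡ-commutes (inj₁ _)        = ≡.refl
  swapˡ-commutes (inj₂ (inj₁ _)) = ≡.refl
  swapˡ-commutes (inj₂ (inj₂ _)) = ≡.refl

≅⇒Conjugate : ∀ {n} {π σ : Permutation′ n} → (π ⟨$⟩ʳ_) ≅ (σ ⟨$⟩ʳ_) → Conjugate π σ
≅⇒Conjugate {π = π} {σ} π≅σ = bijection π≅σ , λ i →
  ≡.sym (≡.trans (commutes π≅σ (from π≅σ i)) (cong (σ ⟨$⟩ʳ_) (strictlyInverseˡ π≅σ i)))

≅⇒≡ : ∀ {m n} {f : Fin m → Fin m} {g : Fin n → Fin n} → f ≅ g → m ≡ n
≅⇒≡ f≅g = ↔⇒≡ (bijection f≅g)

-- ms describes the permutation with cycles of lengths suc m (m ∈ ms), numbered block by block.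
size : List ℕ → ℕ
size []       = 0
size (m ∷ ms) = suc m Nat.+ size ms

blockwise : ∀ ms → (∀ m → Fin (suc m) → Fin (suc m)) → Fin (size ms) → Fin (size ms)
blockwise []       F ()
blockwise (m ∷ ms) F j = join (suc m) (size ms) (Sum.map (F m) (blockwise ms F) (splitAt (suc m) j))

module _ (m : ℕ) (ms : List ℕ) (F : ∀ m → Fin (suc m) → Fin (suc m)) where

  blockwise-join : ∀ x → blockwise (m ∷ ms) F (join (suc m) (size ms) x) ≡ join (suc m) (size ms) (Sum.map (F m) (blockwise ms F) x)
  blockwise-join x = cong (join (suc m) (size ms) ∘ Sum.map (F m) (blockwise ms F)) (splitAt-join (suc m) (size ms) x)

  blockwise-∷ : blockwise (m ∷ ms) F ≅ Sum.map (F m) (blockwise ms F)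
  blockwise-∷ = record { bijection = +↔⊎ ; commutes = λ j → splitAt-join (suc m) (size ms) _ }

join-elim : ∀ a b {P : Fin (a Nat.+ b) → Set} → (∀ x → P (join a b x)) → ∀ j → P j
join-elim a b {P} P-join j = ≡.subst P (join-splitAt a b j) (P-join (splitAt a j))

blockwise-∘ : ∀ ms F G j → blockwise ms F (blockwise ms G j) ≡ blockwise ms (λ m → F m ∘ G m) j
blockwise-∘ []       F G ()
blockwise-∘ (m ∷ ms) F G = join-elim (suc m) (size ms) λ x → begin
  blockwise (m ∷ ms) F (blockwise (m ∷ ms) G (join _ _ x))     ≡⟨ cong (blockwise (m ∷ ms) F) (blockwise-join m ms G x) ⟩
  blockwise (m ∷ ms) F (join _ _ (Sum.map (G m) (blockwise ms G) x))
                                                               ≡⟨ blockwise-join m ms F (Sum.map (G m) (blockwise ms G) x) ⟩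
  join _ _ (Sum.map (F m) (blockwise ms F) (Sum.map (G m) (blockwise ms G) x))
                                                               ≡⟨ cong (join _ _) (map-∘ x) ⟩
  join _ _ (Sum.map (F m ∘ G m) (blockwise ms FG) x)           ≡⟨ blockwise-join m ms FG x ⟨
  blockwise (m ∷ ms) FG (join _ _ x)                           ∎
  where
  open ≡.≡-Reasoning
  FG = λ m → F m ∘ G m
  map-∘ : ∀ x → Sum.map (F m) (blockwise ms F) (Sum.map (G m) (blockwise ms G) x) ≡ Sum.map (F m ∘ G m) (blockwise ms FG) x
  map-∘ (inj₁ i) = ≡.refl
  map-∘ (inj₂ j) = cong inj₂ (blockwise-∘ ms F G j)

blockwise-cong : ∀ ms {F G} → (∀ m i → F m i ≡ G m i) → ∀ j → blockwise ms F j ≡ blockwise ms G j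
blockwise-cong []       F≗G ()
blockwise-cong (m ∷ ms) F≗G j = cong (join (suc m) (size ms)) (Sum.map-cong (F≗G m) (blockwise-cong ms F≗G) (splitAt (suc m) j))

blockwise-id : ∀ ms {F} → (∀ m i → F m i ≡ i) → ∀ j → blockwise ms F j ≡ j
blockwise-id []       F≗id ()
blockwise-id (m ∷ ms) F≗id j = ≡.trans
  (cong (join (suc m) (size ms)) (≡.trans (Sum.map-cong (F≗id m) (blockwise-id ms F≗id) (splitAt (suc m) j)) (Sum.map-id (splitAt (suc m) j))))
  (join-splitAt (suc m) (size ms) j)

↭⇒blockwise-≅ : ∀ F {ms ms′} → ms ↭ ms′ → blockwise ms F ≅ blockwise ms′ F
↭⇒blockwise-≅ F ↭.refl = ≅-refl _
↭⇒blockwise-≅ F {m ∷ ms} {.m ∷ ms′} (↭.prep m p) =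
  ≅-trans (blockwise-∷ m ms F) (≅-trans (≅-refl (F m) ⊎-≅ ↭⇒blockwise-≅ F p) (≅-sym (blockwise-∷ m ms′ F)))
↭⇒blockwise-≅ F {a ∷ b ∷ ms} {.b ∷ .a ∷ ms′} (↭.swap a b p) =
  ≅-trans (blockwise-∷ a (b ∷ ms) F)
  (≅-trans (≅-refl (F a) ⊎-≅ blockwise-∷ b ms F)
  (≅-trans (⊎-swapˡ-≅ (F a) (F b) (blockwise ms F))
  (≅-trans (≅-refl (F b) ⊎-≅ (≅-refl (F a) ⊎-≅ ↭⇒blockwise-≅ F p))
  (≅-trans (≅-refl (F b) ⊎-≅ ≅-sym (blockwise-∷ a ms′ F))
           (≅-sym (blockwise-∷ b (a ∷ ms′) F))))))
↭⇒blockwise-≅ F (↭.trans p q) = ≅-trans (↭⇒blockwise-≅ F p) (↭⇒blockwise-≅ F q)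

rotations : ℕ → ∀ m → Fin (suc m) → Fin (suc m)
rotations k m = Rotation.rotate m k

cycleProduct : ∀ ms → Permutation′ (size ms)
cycleProduct ms = permutation (blockwise ms (rotations 1)) (blockwise ms (λ m → rotate m m)) forward∘backward backward∘forward
  where
  open Rotation
  forward∘backward : ∀ j → blockwise ms (rotations 1) (blockwise ms (λ m → rotate m m) j) ≡ j
  forward∘backward j = ≡.trans (blockwise-∘ ms _ _ j) (blockwise-id ms (λ m i →
    ≡.trans (rotate-∘ m 1 m i) (≡.trans (cong (λ k → rotate m k i) (ℕₚ.+-comm m 1)) (rotate-full m i))) j)
  backward∘forward : ∀ j → blockwise ms (λ m → rotate m m) (blockwise ms (rotations 1) j) ≡ j
  backward∘forward j = ≡.trans (blockwise-∘ ms _ _ j) (blockwise-id ms (λ m i → ≡.trans (rotate-∘ m m 1 i) (rotate-full m i)) j)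

HasCycleType : ∀ {n} → Permutation′ n → List ℕ → Set
HasCycleType ρ ms = blockwise ms (rotations 1) ≅ (ρ ⟨$⟩ʳ_)

cycleProduct-^ₚ : ∀ ms k j → cycleProduct ms ^ₚ k ⟨$⟩ʳ j ≡ blockwise ms (rotations k) j
cycleProduct-^ₚ ms zero    j = ≡.sym (blockwise-id ms (λ m → Rotation.rotate-0 m) j)
cycleProduct-^ₚ ms (suc k) j = ≡.trans (cong (blockwise ms (rotations 1)) (cycleProduct-^ₚ ms k j))
  (≡.trans (blockwise-∘ ms _ _ j) (blockwise-cong ms (λ m i →
    ≡.trans (Rotation.rotate-∘ m 1 k i) (cong (λ k′ → Rotation.rotate m k′ i) (ℕₚ.+-comm k 1))) j))

lookup-++-join : ∀ {A : Set} {a b} (B : Vec A a) (C : Vec A b) x → lookup (B ++ C) (join a b x) ≡ Sum.[ lookup B , lookup C ] x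
lookup-++-join B C (inj₁ i) = lookup-++ˡ B C i
lookup-++-join B C (inj₂ j) = lookup-++ʳ B C j

module _ {m ms} {F : ∀ m → Fin (suc m) → Fin (suc m)} (B : Subset (suc m)) (C : Subset (size ms)) where
  open ≡.≡-Reasoning

  private
    lookup⊎ : Fin (suc m) ⊎ Fin (size ms) → Bool
    lookup⊎ = Sum.[ lookup B , lookup C ]

    F⊎ : Fin (suc m) ⊎ Fin (size ms) → Fin (suc m) ⊎ Fin (size ms)
    F⊎ = Sum.map (F m) (blockwise ms F)

    invariant-join : Invariant (blockwise (m ∷ ms) F) (B ++ C) → ∀ x → lookup⊎ (F⊎ x) ≡ lookup⊎ x
    invariant-join inv x = begin
      lookup⊎ (F⊎ x)                                    ≡⟨ lookup-++-join B C (F⊎ x) ⟨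
      lookup (B ++ C) (join _ _ (F⊎ x))                 ≡⟨ cong (lookup (B ++ C)) (blockwise-join m ms F x) ⟨
      lookup (B ++ C) (blockwise (m ∷ ms) F (join _ _ x)) ≡⟨ inv (join _ _ x) ⟩
      lookup (B ++ C) (join _ _ x)                      ≡⟨ lookup-++-join B C x ⟩
      lookup⊎ x                                         ∎

  invariant-++⁻ : Invariant (blockwise (m ∷ ms) F) (B ++ C) → Invariant (F m) B × Invariant (blockwise ms F) C
  invariant-++⁻ inv = (λ i → invariant-join inv (inj₁ i)) , (λ j → invariant-join inv (inj₂ j))

  invariant-++⁺ : Invariant (F m) B × Invariant (blockwise ms F) C → Invariant (blockwise (m ∷ ms) F) (B ++ C)
  invariant-++⁺ (invB , invC) = join-elim (suc m) (size ms) λ x → begin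
    lookup (B ++ C) (blockwise (m ∷ ms) F (join _ _ x)) ≡⟨ cong (lookup (B ++ C)) (blockwise-join m ms F x) ⟩
    lookup (B ++ C) (join _ _ (F⊎ x))                 ≡⟨ lookup-++-join B C (F⊎ x) ⟩
    lookup⊎ (F⊎ x)                                    ≡⟨ invariant⊎ x ⟩
    lookup⊎ x                                         ≡⟨ lookup-++-join B C x ⟨
    lookup (B ++ C) (join _ _ x)                      ∎
    where
    invariant⊎ : ∀ x → lookup⊎ (F⊎ x) ≡ lookup⊎ x
    invariant⊎ (inj₁ i) = invB i
    invariant⊎ (inj₂ j) = invC j

-- the number of cycles of cycleProduct ms ^ₚ k
cycleCount : ℕ → List ℕ → ℕ
cycleCount k []       = 0
cycleCount k (m ∷ ms) = gcd (suc m) k Nat.+ cycleCount k ms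

module _ {c ℓ : Level} (K : CommutativeRing c ℓ) where
  open CommutativeRing K
  open PowerSetSums K
  open import Relation.Binary.Reasoning.Setoid setoid

  ⟦invariant-++⟧ : ∀ {m ms} (F : ∀ m → Fin (suc m) → Fin (suc m)) (B : Subset (suc m)) (C : Subset (size ms)) →
                  ⟦ invariant? (blockwise (m ∷ ms) F) (B ++ C) ⟧ ≈ ⟦ invariant? (F m) B ⟧ * ⟦ invariant? (blockwise ms F) C ⟧
  ⟦invariant-++⟧ {m} {ms} F B C = trans
    (⟦⟧-cong (invariant? (blockwise (m ∷ ms) F) (B ++ C)) (invariant? (F m) B ×-dec invariant? (blockwise ms F) C)
             (invariant-++⁻ {m} {ms} {F} B C) (invariant-++⁺ {m} {ms} {F} B C))
    (⟦×⟧ (invariant? (F m) B) (invariant? (blockwise ms F) C))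

  ∑ₚ-invariant-blockwise : ∀ k ms → ∑ₚ (λ A → ⟦ invariant? (blockwise ms (rotations k)) A ⟧) ≈ natK K (2 ^ cycleCount k ms)
  ∑ₚ-invariant-blockwise k []       = +-congʳ (⟦yes⟧ (invariant? (blockwise [] (rotations k)) []) (λ ()))
  ∑ₚ-invariant-blockwise k (m ∷ ms) = begin
    ∑ₚ {size (m ∷ ms)} (λ A → ⟦ invariant? (blockwise (m ∷ ms) F) A ⟧)
      ≈⟨ ∑ₚ-++ (suc m) (size ms) (λ A → ⟦ invariant? (blockwise (m ∷ ms) F) A ⟧) ⟩
    ∑ₚ {suc m} (λ B → ∑ₚ {size ms} (λ C → ⟦ invariant? (blockwise (m ∷ ms) F) (B ++ C) ⟧))
      ≈⟨ ∑-cong (powerSet (suc m)) (λ B → ∑-cong (powerSet (size ms)) (⟦invariant-++⟧ {m} {ms} F B)) ⟩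
    ∑ₚ {suc m} (λ B → ∑ₚ {size ms} (λ C → ⟦ invariant? (F m) B ⟧ * ⟦ invariant? (blockwise ms F) C ⟧))
      ≈⟨ ∑-product (powerSet (suc m)) (powerSet (size ms)) _ _ ⟩
    ∑ₚ {suc m} (λ B → ⟦ invariant? (F m) B ⟧) * ∑ₚ {size ms} (λ C → ⟦ invariant? (blockwise ms F) C ⟧)
      ≈⟨ *-cong (RotationInvariants.∑ₚ-invariant-rotate m K k) (∑ₚ-invariant-blockwise k ms) ⟩
    natK K (2 ^ gcd (suc m) k) * natK K (2 ^ cycleCount k ms)
      ≈⟨ natK-* (2 ^ gcd (suc m) k) (2 ^ cycleCount k ms) ⟨
    natK K (2 ^ gcd (suc m) k Nat.* 2 ^ cycleCount k ms)
      ≈⟨ reflexive (cong (natK K) (^-distribˡ-+-* 2 (gcd (suc m) k) (cycleCount k ms))) ⟨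
    natK K (2 ^ cycleCount k (m ∷ ms))
      ∎
    where F = rotations k

-- Cycle decomposition

Minimal : ∀ {p} → (ℕ → Set p) → ℕ → Set p
Minimal P m = P m × (∀ {k} → k < m → ¬ P k)

least : ∀ {p} {P : ℕ → Set p} → (∀ k → Dec (P k)) → ∀ {n} → P n → ∃ (Minimal P)
least {P = P} P? = <-rec (λ n → P n → ∃ (Minimal P)) search _
  where
  search : ∀ n → (∀ {k} → k < n → P k → ∃ (Minimal P)) → P n → ∃ (Minimal P)
  search n rec Pn with anyUpTo? P? n
  ... | yes (k , k<n , Pk) = rec k<n Pk
  ... | no  none           = n , Pn , λ k<n Pk → none (_ , k<n , Pk)

count : ∀ {n} → (Fin n → Bool) → ℕ
count {zero}  U = 0
count {suc n} U = Bool.if U zero then suc (count (U ∘ suc)) else count (U ∘ suc)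

count-split : ∀ {n} (U V : Fin n → Bool) → count U ≡ count (λ y → U y ∧ V y) Nat.+ count (λ y → U y ∧ not (V y))
count-split {zero}  U V = ≡.refl
count-split {suc n} U V with U zero | V zero
... | true  | true  = cong suc (count-split (U ∘ suc) (V ∘ suc))
... | true  | false = ≡.trans (cong suc (count-split (U ∘ suc) (V ∘ suc))) (≡.sym (+-suc _ _))
... | false | _     = count-split (U ∘ suc) (V ∘ suc)

count-positive : ∀ {n} (U : Fin n → Bool) y → Bool.T (U y) → 1 ≤ count U
count-positive U zero    Uy with U zero
... | true = s≤s z≤n
count-positive U (suc y) Uy with U zero
... | true  = s≤s z≤n
... | false = count-positive (U ∘ suc) y Uy

¬T⇒T-not : ∀ {b} → ¬ Bool.T b → Bool.T (not b)
¬T⇒T-not {true}  ¬b = ⊥-elim (¬b tt)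
¬T⇒T-not {false} _  = tt

T-not⇒¬T : ∀ {b} → Bool.T (not b) → ¬ Bool.T b
T-not⇒¬T {true} ()

module CycleDecomposition {n : ℕ} (ρ : Permutation′ n) where
  open Nat using (_+_; _%_)
  open Periodicity using (Periodic; periodic-%)
  open ≡.≡-Reasoning

  f : Fin n → Fin n
  f = ρ ⟨$⟩ʳ_

  iter : ℕ → Fin n → Fin n
  iter k x = fold x f k

  f-injective : ∀ {a b} → f a ≡ f b → a ≡ b
  f-injective fa≡fb = ≡.trans (≡.sym (inverseˡ ρ)) (≡.trans (cong (ρ ⟨$⟩ˡ_) fa≡fb) (inverseˡ ρ))

  iter-injective : ∀ k {a b} → iter k a ≡ iter k b → a ≡ b
  iter-injective zero    = id
  iter-injective (suc k) = iter-injective k ∘ f-injective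

  iter-+ : ∀ a b x → iter (a + b) x ≡ iter a (iter b x)
  iter-+ a b x = fold-+ x f a

  Closed : (Fin n → Bool) → Set
  Closed U = ∀ y → U (f y) ≡ U y

  closed-iter : ∀ {U} → Closed U → ∀ k y → U (iter k y) ≡ U y
  closed-iter closed zero    y = ≡.refl
  closed-iter closed (suc k) y = ≡.trans (closed (iter k y)) (closed-iter closed k y)

  Points : (Fin n → Bool) → Set
  Points U = Σ (Fin n) (Bool.T ∘ U)

  points-≡ : ∀ {U} {p q : Points U} → proj₁ p ≡ proj₁ q → p ≡ q
  points-≡ {p = y , _} {.y , _} ≡.refl = cong (y ,_) (T-irrelevant _ _)

  restrict : ∀ {U} → Closed U → Points U → Points U
  restrict closed (y , Uy) = f y , ≡.subst Bool.T (≡.sym (closed y)) Uy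

  module Orbit (x : Fin n) where

    returns : ∃ λ d → iter (suc d) x ≡ x
    returns with pigeonhole ≤-refl (λ (i : Fin (suc n)) → iter (toℕ i) x)
    ... | i , j , i<j , same with m≤n⇒∃[o]m+o≡n i<j
    ... | o , i+1+o≡j = o , iter-injective (toℕ i) (begin
      iter (toℕ i) (iter (suc o) x) ≡⟨ iter-+ (toℕ i) (suc o) x ⟨
      iter (toℕ i + suc o) x        ≡⟨ cong (λ k → iter k x) (≡.trans (+-suc (toℕ i) o) i+1+o≡j) ⟩
      iter (toℕ j) x                ≡⟨ same ⟨
      iter (toℕ i) x                ∎)

    -- opaque, so that m is never unfolded to the search that computes it
    opaque
      period : ∃ (Minimal (λ d → iter (suc d) x ≡ x))
      period = least (λ d → iter (suc d) x ≟ x) {proj₁ returns} (proj₂ returns)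

    m : ℕ
    m = proj₁ period

    iter-period : iter (suc m) x ≡ x
    iter-period = proj₁ (proj₂ period)

    iter-periodic : Periodic (suc m) (λ k → iter k x)
    iter-periodic k = ≡.trans (iter-+ k (suc m) x) (cong (iter k) iter-period)

    iter-distinct : ∀ {i j} → i < j → j ≤ m → iter i x ≢ iter j x
    iter-distinct {i} {j} i<j j≤m same with m≤n⇒∃[o]m+o≡n i<j
    ... | o , i+1+o≡j = proj₂ (proj₂ period) (≤-trans (s≤s (m≤n+m o i)) (≤-trans (≤-reflexive i+1+o≡j) j≤m))
      (≡.sym (iter-injective i (begin
        iter i x                 ≡⟨ same ⟩
        iter j x                 ≡⟨ cong (λ k → iter k x) (≡.trans (+-suc i o) i+1+o≡j) ⟨
        iter (i + suc o) x       ≡⟨ iter-+ i (suc o) x ⟩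
        iter i (iter (suc o) x)  ∎)))

    orbit-injective : ∀ (i j : Fin (suc m)) → iter (toℕ i) x ≡ iter (toℕ j) x → i ≡ j
    orbit-injective i j same with <-cmp (toℕ i) (toℕ j)
    ... | tri< i<j _ _ = ⊥-elim (iter-distinct i<j (≤-pred (toℕ<n j)) same)
    ... | tri≈ _ i≡j _ = toℕ-injective i≡j
    ... | tri> _ _ j<i = ⊥-elim (iter-distinct j<i (≤-pred (toℕ<n i)) (≡.sym same))

    iter-rotate : ∀ k i → iter (toℕ (Rotation.rotate m k i)) x ≡ iter (toℕ i + k) x
    iter-rotate k i = ≡.trans (cong (λ j → iter j x) (Rotation.toℕ-rotate m k i)) (periodic-% iter-periodic (toℕ i + k))

    iter-rotate-1 : ∀ i → iter (toℕ (Rotation.rotate m 1 i)) x ≡ f (iter (toℕ i) x)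
    iter-rotate-1 i = ≡.trans (iter-rotate 1 i) (cong (λ j → iter j x) (ℕₚ.+-comm (toℕ i) 1))

    f-iter-rotate-m : ∀ i → f (iter (toℕ (Rotation.rotate m m i)) x) ≡ iter (toℕ i) x
    f-iter-rotate-m i = begin
      f (iter (toℕ (Rotation.rotate m m i)) x)  ≡⟨ cong f (iter-rotate m i) ⟩
      iter (suc (toℕ i + m)) x                  ≡⟨ cong (λ j → iter j x) (+-suc (toℕ i) m) ⟨
      iter (toℕ i + suc m) x                    ≡⟨ iter-periodic (toℕ i) ⟩
      iter (toℕ i) x                            ∎

    InOrbit : Fin n → Set
    InOrbit y = ∃ λ (i : Fin (suc m)) → iter (toℕ i) x ≡ y

    inOrbit? : ∀ y → Dec (InOrbit y)
    inOrbit? y = any? (λ i → iter (toℕ i) x ≟ y)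

    orbit : Fin n → Bool
    orbit y = ⌊ inOrbit? y ⌋

    orbit-closed : Closed orbit
    orbit-closed y = ≡.trans (isYes≗does (inOrbit? (f y)))
      (≡.trans (does-⇔ (mk⇔ backward forward) (inOrbit? (f y)) (inOrbit? y)) (≡.sym (isYes≗does (inOrbit? y))))
      where
      forward : InOrbit y → InOrbit (f y)
      forward (i , iᵗʰ≡y) = Rotation.rotate m 1 i , ≡.trans (iter-rotate-1 i) (cong f iᵗʰ≡y)
      backward : InOrbit (f y) → InOrbit y
      backward (i , iᵗʰ≡fy) = Rotation.rotate m m i , f-injective (≡.trans (f-iter-rotate-m i) iᵗʰ≡fy)

    rotate≅orbit : Rotation.rotate m 1 ≅ restrict orbit-closed
    rotate≅orbit = record
      { bijection = mk↔ₛ′ point index point-index index-point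
      ; commutes  = λ i → points-≡ (iter-rotate-1 i)
      }
      where
      point : Fin (suc m) → Points orbit
      point i = iter (toℕ i) x , fromWitness (i , ≡.refl)
      index : Points orbit → Fin (suc m)
      index (y , y∈orbit) = proj₁ (toWitness y∈orbit)
      point-index : ∀ p → point (index p) ≡ p
      point-index (y , y∈orbit) = points-≡ (proj₂ (toWitness y∈orbit))
      index-point : ∀ i → index (point i) ≡ i
      index-point i = orbit-injective _ i (proj₂ (toWitness (proj₂ (point i))))

  module _ {U V : Fin n → Bool} (U-closed : Closed U) (V-closed : Closed V) (V⊆U : ∀ y → Bool.T (V y) → Bool.T (U y)) where

    U∖V : Fin n → Bool
    U∖V y = U y ∧ not (V y)

    ∖-closed : Closed U∖V
    ∖-closed y = ≡.cong₂ (λ a b → a ∧ not b) (U-closed y) (V-closed y)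

    split-≅ : Sum.map (restrict V-closed) (restrict ∖-closed) ≅ restrict U-closed
    split-≅ = record
      { bijection = mk↔ₛ′ merge separate merge-separate separate-merge
      ; commutes  = λ { (inj₁ _) → points-≡ ≡.refl ; (inj₂ _) → points-≡ ≡.refl }
      }
      where
      merge : Points V ⊎ Points U∖V → Points U
      merge (inj₁ (y , Vy))   = y , V⊆U y Vy
      merge (inj₂ (y , U∖Vy)) = y , proj₁ (Equivalence.to T-∧ U∖Vy)
      separate : Points U → Points V ⊎ Points U∖V
      separate (y , Uy) with T? (V y)
      ... | yes Vy = inj₁ (y , Vy)
      ... | no ¬Vy = inj₂ (y , Equivalence.from T-∧ (Uy , ¬T⇒T-not ¬Vy))
      merge-separate : ∀ p → merge (separate p) ≡ p
      merge-separate (y , Uy) with T? (V y)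
      ... | yes _ = points-≡ ≡.refl
      ... | no  _ = points-≡ ≡.refl
      separate-merge : ∀ z → separate (merge z) ≡ z
      separate-merge (inj₁ (y , Vy)) with T? (V y)
      ... | yes _  = cong inj₁ (points-≡ ≡.refl)
      ... | no ¬Vy = ⊥-elim (¬Vy Vy)
      separate-merge (inj₂ (y , U∖Vy)) with T? (V y)
      ... | yes Vy = ⊥-elim (T-not⇒¬T (proj₂ (Equivalence.to T-∧ U∖Vy)) Vy)
      ... | no  _  = cong inj₂ (points-≡ ≡.refl)

  empty-≅ : ∀ {U} (closed : Closed U) → (∀ y → ¬ Bool.T (U y)) → blockwise [] (rotations 1) ≅ restrict closed
  empty-≅ closed empty = record
    { bijection = mk↔ₛ′ (λ ()) (λ (y , Uy) → ⊥-elim (empty y Uy)) (λ (y , Uy) → ⊥-elim (empty y Uy)) (λ ())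
    ; commutes  = λ ()
    }

  module Peel {U} (closed : Closed U) (x : Fin n) (Ux : Bool.T (U x)) where
    open Orbit x public using (m; orbit; orbit-closed; rotate≅orbit)

    orbit⊆U : ∀ y → Bool.T (orbit y) → Bool.T (U y)
    orbit⊆U y y∈orbit with toWitness y∈orbit
    ... | i , ≡.refl = ≡.subst Bool.T (≡.sym (closed-iter closed (toℕ i) x)) Ux

    rest-closed : Closed (λ y → U y ∧ not (orbit y))
    rest-closed = ∖-closed closed orbit-closed orbit⊆U

    count-rest : ∀ {fuel} → count U ≤ suc fuel → count (λ y → U y ∧ not (orbit y)) ≤ fuel
    count-rest bound = ≤-pred (≤-trans (+-monoˡ-≤ _ (count-positive (λ y → U y ∧ orbit y) x x∈U∩orbit))
                                       (≤-trans (≤-reflexive (≡.sym (count-split U orbit))) bound))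
      where
      x∈U∩orbit : Bool.T (U x ∧ orbit x)
      x∈U∩orbit = Equivalence.from T-∧ (Ux , fromWitness (zero , ≡.refl))

    peel-≅ : ∀ {ms} → blockwise ms (rotations 1) ≅ restrict rest-closed → blockwise (m ∷ ms) (rotations 1) ≅ restrict closed
    peel-≅ {ms} rest-≅ =
      ≅-trans (blockwise-∷ m ms (rotations 1)) (≅-trans (rotate≅orbit ⊎-≅ rest-≅) (split-≅ closed orbit-closed orbit⊆U))

  decompose : ∀ fuel {U} (closed : Closed U) → count U ≤ fuel → ∃ λ ms → blockwise ms (rotations 1) ≅ restrict closed
  decompose fuel {U} closed bound = decompose′ fuel closed bound (any? (λ y → T? (U y)))
    where
    decompose′ : ∀ fuel {U} (closed : Closed U) → count U ≤ fuel → Dec (∃ λ y → Bool.T (U y)) →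
                 ∃ λ ms → blockwise ms (rotations 1) ≅ restrict closed
    decompose′ _          closed _     (no none)      = [] , empty-≅ closed (λ y Uy → none (y , Uy))
    decompose′ zero       {U} closed bound (yes (x , Ux)) = ⊥-elim (1+n≰n (≤-trans (count-positive U x Ux) bound))
    decompose′ (suc fuel) closed bound (yes (x , Ux)) =
      extend (decompose fuel rest-closed (count-rest bound))
      where
      open Peel closed x Ux
      extend : ∃ (λ ms → blockwise ms (rotations 1) ≅ restrict rest-closed) → ∃ λ ms → blockwise ms (rotations 1) ≅ restrict closed
      extend (ms , rest-≅) = m ∷ ms , peel-≅ {ms} rest-≅

  whole-≅ : restrict {λ _ → true} (λ _ → ≡.refl) ≅ f
  whole-≅ = record { bijection = mk↔ₛ′ proj₁ (_, tt) (λ _ → ≡.refl) (λ _ → ≡.refl) ; commutes = λ _ → ≡.refl }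

cycleType : ∀ {n} (ρ : Permutation′ n) → ∃ (HasCycleType ρ)
cycleType ρ = map₂ (λ ≅whole → ≅-trans ≅whole whole-≅) (decompose _ (λ _ → ≡.refl) ≤-refl)
  where open CycleDecomposition ρ

module CycleCounts where
  open import Data.Nat using (_+_; _*_; _/_; _>_; >-nonZero)
  open import Data.Nat.Properties
  open import Data.Nat.DivMod using (m*[n/m]≡n; m/n<m; m≥n⇒m/n>0)
  open import Data.Nat.Divisibility using (_∣?_; ∣-trans; ∣-refl; *-monoʳ-∣; *-monoˡ-∣; *-cancelˡ-∣; ∣m∣n⇒∣m+n; ∣m+n∣m⇒∣n; n∣m*n; ∣⇒≤; _∣0)
  open import Data.Nat.Coprimality using (Coprime; coprime?; coprime-/gcd; coprime-divisor; coprime⇒gcd≡1; gcd≡1⇒coprime; coprime-+; 1-coprimeTo)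
  import Data.Nat.Coprimality as Coprimality
  open import Data.Bool using (if_then_else_)
  open import Data.List using (filter; length)
  open import Data.List.Properties using (filter-some; filter-none)
  open import Data.List.Relation.Unary.Any as Any using (here; there)
  open import Data.List.Relation.Unary.All as All using (All; _∷_)
  import Data.List.Relation.Unary.All.Properties as All
  open import Data.List.Relation.Unary.All.Properties.Core using (¬Any⇒All¬)
  open import Data.List.Membership.Propositional using (_∈_; find)
  open import Data.List.Membership.Propositional.Properties using (∈-∃++; ∈-++⁻)
  open import Data.List.Relation.Binary.Permutation.Propositional using (↭-refl; ↭-prep; ↭-sym; ↭-trans)
  open import Data.List.Relation.Binary.Permutation.Propositional.Properties using (↭-length; filter-↭; shift)
  open import Data.List.Extrema.Nat using (max; argmax-all; ⊥≤max; xs≤max)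

  indicator : ∀ {p} {P : Set p} → Dec P → ℕ
  indicator P? = if does P? then 1 else 0

  indicator-cong : ∀ {p q} {P : Set p} {Q : Set q} (P? : Dec P) (Q? : Dec Q) → (P → Q) → (Q → P) → indicator P? ≡ indicator Q?
  indicator-cong (yes _) (yes _) _  _  = ≡.refl
  indicator-cong (yes p) (no ¬q) to _  = ⊥-elim (¬q (to p))
  indicator-cong (no ¬p) (yes q) _ from = ⊥-elim (¬p (from q))
  indicator-cong (no _)  (no _)  _  _  = ≡.refl

  indicator-yes : ∀ {p} {P : Set p} (P? : Dec P) → P → indicator P? ≡ 1
  indicator-yes P? p rewrite dec-true P? p = ≡.refl

  indicator-no : ∀ {p} {P : Set p} (P? : Dec P) → ¬ P → indicator P? ≡ 0
  indicator-no P? ¬p rewrite dec-false P? ¬p = ≡.refl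

  ∑< : ℕ → (ℕ → ℕ) → ℕ
  ∑< zero    f = 0
  ∑< (suc n) f = f n + ∑< n f

  ∑<-cong : ∀ n {f g : ℕ → ℕ} → (∀ j → f j ≡ g j) → ∑< n f ≡ ∑< n g
  ∑<-cong zero    f≗g = ≡.refl
  ∑<-cong (suc n) f≗g = cong₂ _+_ (f≗g n) (∑<-cong n f≗g)

  ∑<-distrib-+ : ∀ n (f g : ℕ → ℕ) → ∑< n (λ j → f j + g j) ≡ ∑< n f + ∑< n g
  ∑<-distrib-+ zero    f g = ≡.refl
  ∑<-distrib-+ (suc n) f g = ≡.trans (cong (f n + g n +_) (∑<-distrib-+ n f g)) (+-+-comm (f n) (g n) _ _)
    where open import Algebra.Properties.CommutativeSemigroup +-commutativeSemigroup using () renaming (interchange to +-+-comm)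

  ∑<-*ʳ : ∀ n (f : ℕ → ℕ) x → ∑< n (λ j → f j * x) ≡ ∑< n f * x
  ∑<-*ʳ zero    f x = ≡.refl
  ∑<-*ʳ (suc n) f x = ≡.trans (cong (f n * x +_) (∑<-*ʳ n f x)) (≡.sym (*-distribʳ-+ x (f n) _))

  ∑<-+ : ∀ a b (f : ℕ → ℕ) → ∑< (a + b) f ≡ ∑< a (λ j → f (j + b)) + ∑< b f
  ∑<-+ zero    b f = ≡.refl
  ∑<-+ (suc a) b f = ≡.trans (cong (f (a + b) +_) (∑<-+ a b f)) (≡.sym (+-assoc (f (a + b)) _ _))

  ∑<-zero : ∀ n → ∑< n (λ _ → 0) ≡ 0
  ∑<-zero zero    = ≡.refl
  ∑<-zero (suc n) = ∑<-zero n

  multiples-below : ∀ g d → ∑< (g * suc d) (λ j → indicator (suc d ∣? j)) ≡ g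
  multiples-below zero    d = ≡.refl
  multiples-below (suc g) d = begin
    ∑< (suc d + g * suc d) F                                   ≡⟨ ∑<-+ (suc d) (g * suc d) F ⟩
    ∑< (suc d) (λ j → F (j + g * suc d)) + ∑< (g * suc d) F    ≡⟨ cong₂ _+_ (∑<-cong (suc d) translate) (multiples-below g d) ⟩
    ∑< (suc d) F + g                                           ≡⟨ cong (_+ g) (only-zero d ≤-refl) ⟩
    suc g                                                      ∎
    where
    open ≡.≡-Reasoning
    F : ℕ → ℕ
    F j = indicator (suc d ∣? j)
    translate : ∀ j → F (j + g * suc d) ≡ F j
    translate j = indicator-cong (suc d ∣? (j + g * suc d)) (suc d ∣? j)
      (λ d∣j+gd → ∣m+n∣m⇒∣n (≡.subst (suc d ∣_) (+-comm j _) d∣j+gd) (n∣m*n g))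
      (λ d∣j → ∣m∣n⇒∣m+n d∣j (n∣m*n g))
    only-zero : ∀ n → n ≤ d → ∑< (suc n) F ≡ 1
    only-zero zero    _   = cong (_+ 0) (indicator-yes (suc d ∣? 0) (suc d ∣0))
    only-zero (suc n) n<d = ≡.trans (cong (_+ ∑< (suc n) F) (indicator-no (suc d ∣? suc n) (λ d∣n → <⇒≱ (s≤s n<d) (∣⇒≤ d∣n))))
                                    (only-zero n (<⇒≤ n<d))

  multiples : ℕ → List ℕ → ℕ
  multiples d ms = length (filter (λ m → d ∣? suc m) ms)

  multiples-∷ : ∀ d m ms → multiples d (m ∷ ms) ≡ indicator (d ∣? suc m) + multiples d ms
  multiples-∷ d m ms with d ∣? suc m
  ... | yes _ = ≡.refl
  ... | no  _ = ≡.refl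

  coprime-suc : ∀ k → Coprime k (suc k)
  coprime-suc k = ≡.subst (Coprime k) (+-comm k 1) (Coprimality.sym (coprime-+ (1-coprimeTo k)))

  -- order j is the additive order of j in ℤ/(suc k).
  module Order (k : ℕ) where

    gcd≢0 : ∀ j → NonZero (gcd j (suc k))
    gcd≢0 j = ≢-nonZero (gcd[m,n]≢0 j (suc k) (inj₂ (λ ())))

    order : ℕ → ℕ
    order j = (suc k / gcd j (suc k)) {{gcd≢0 j}}

    module _ (j : ℕ) where
      private
        instance
          _ = gcd≢0 j
        g = gcd j (suc k)

      gcd*order : g * order j ≡ suc k
      gcd*order = m*[n/m]≡n (gcd[m,n]∣n j (suc k))

      ∣*⇒order∣ : ∀ b → suc k ∣ j * b → order j ∣ b
      ∣*⇒order∣ b k∣jb = coprime-divisor (Coprimality.sym (coprime-/gcd j (suc k)))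
        (*-cancelˡ-∣ g (≡.subst₂ _∣_ (≡.sym gcd*order) (≡.trans (cong (_* b) (≡.sym g*j′≡j)) (*-assoc g (j / g) b)) k∣jb))
        where
        g*j′≡j : g * (j / g) ≡ j
        g*j′≡j = m*[n/m]≡n (gcd[m,n]∣m j (suc k))

      order∣⇒∣* : ∀ b → order j ∣ b → suc k ∣ j * b
      order∣⇒∣* b o∣b = ∣-trans (≡.subst (_∣ g * b) gcd*order (*-monoʳ-∣ g o∣b)) (*-monoˡ-∣ b (gcd[m,n]∣m j (suc k)))

      order-positive : 0 < order j
      order-positive = m≥n⇒m/n>0 (∣⇒≤ (gcd[m,n]∣n j (suc k)))

      order-coprime : Coprime j (suc k) → order j ≡ suc k
      order-coprime coprime = begin
        order j          ≡⟨ *-identityˡ (order j) ⟨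
        1 * order j      ≡⟨ cong (_* order j) (coprime⇒gcd≡1 coprime) ⟨
        g * order j      ≡⟨ gcd*order ⟩
        suc k            ∎
        where open ≡.≡-Reasoning

      order-< : ¬ Coprime j (suc k) → order j < suc k
      order-< ¬coprime = m/n<m (suc k) g (≤∧≢⇒< (n≢0⇒n>0 (gcd[m,n]≢0 j (suc k) (inj₂ (λ ()))))
                                                (λ 1≡g → ¬coprime (gcd≡1⇒coprime (≡.sym 1≡g))))

    -- Both sides count the j < suc k with suc k ∣ l * j, i.e. the multiples of order l.
    gcd-as-count : ∀ l → gcd l (suc k) ≡ ∑< (suc k) (λ j → indicator (order j ∣? l))
    gcd-as-count l = ≡.sym (begin
      ∑< (suc k) (λ j → indicator (order j ∣? l))
        ≡⟨ ∑<-cong (suc k) (λ j → indicator-cong (order j ∣? l) (order l ∣? j)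
             (∣*⇒order∣ l j ∘ ≡.subst (suc k ∣_) (*-comm j l) ∘ order∣⇒∣* j l)
             (∣*⇒order∣ j l ∘ ≡.subst (suc k ∣_) (*-comm l j) ∘ order∣⇒∣* l j)) ⟩
      ∑< (suc k) (λ j → indicator (order l ∣? j))
        ≡⟨ cong (λ n → ∑< n (λ j → indicator (order l ∣? j))) (gcd*order l) ⟨
      ∑< (gcd l (suc k) * order l) (λ j → indicator (order l ∣? j))
        ≡⟨ multiples-below′ (order l) (order-positive l) ⟩
      gcd l (suc k)
        ∎)
      where
      open ≡.≡-Reasoning
      multiples-below′ : ∀ o → 0 < o → ∑< (gcd l (suc k) * o) (λ j → indicator (o ∣? j)) ≡ gcd l (suc k)
      multiples-below′ (suc d) _ = multiples-below (gcd l (suc k)) d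

    cycleCount-as-∑< : ∀ ms → cycleCount (suc k) ms ≡ ∑< (suc k) (λ j → multiples (order j) ms)
    cycleCount-as-∑< []       = ≡.sym (∑<-zero (suc k))
    cycleCount-as-∑< (m ∷ ms) = begin
      gcd (suc m) (suc k) + cycleCount (suc k) ms
        ≡⟨ cong₂ _+_ (gcd-as-count (suc m)) (cycleCount-as-∑< ms) ⟩
      ∑< (suc k) (λ j → indicator (order j ∣? suc m)) + ∑< (suc k) (λ j → multiples (order j) ms)
        ≡⟨ ∑<-distrib-+ (suc k) (λ j → indicator (order j ∣? suc m)) (λ j → multiples (order j) ms) ⟨
      ∑< (suc k) (λ j → indicator (order j ∣? suc m) + multiples (order j) ms)
        ≡⟨ ∑<-cong (suc k) (λ j → multiples-∷ (order j) m ms) ⟨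
      ∑< (suc k) (λ j → multiples (order j) (m ∷ ms))
        ∎
      where open ≡.≡-Reasoning

    coprimes : ℕ
    coprimes = ∑< (suc k) (λ j → indicator (coprime? j (suc k)))

    coprimes-positive : coprimes > 0
    coprimes-positive = ≤-trans (≤-reflexive (≡.sym (indicator-yes (coprime? k (suc k)) (coprime-suc k)))) (m≤m+n _ _)

    unlessCoprime : ∀ {j} → Dec (Coprime j (suc k)) → List ℕ → ℕ
    unlessCoprime     (yes _) xs = 0
    unlessCoprime {j} (no  _) xs = multiples (order j) xs

    noncoprimeTerms : List ℕ → ℕ
    noncoprimeTerms xs = ∑< (suc k) (λ j → unlessCoprime (coprime? j (suc k)) xs)

    cycleCount-split : ∀ xs → cycleCount (suc k) xs ≡ coprimes * multiples (suc k) xs + noncoprimeTerms xs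
    cycleCount-split xs = begin
      cycleCount (suc k) xs
        ≡⟨ cycleCount-as-∑< xs ⟩
      ∑< (suc k) (λ j → multiples (order j) xs)
        ≡⟨ ∑<-cong (suc k) (λ j → split-term j (coprime? j (suc k))) ⟩
      ∑< (suc k) (λ j → indicator (coprime? j (suc k)) * multiples (suc k) xs + unlessCoprime (coprime? j (suc k)) xs)
        ≡⟨ ∑<-distrib-+ (suc k) (λ j → indicator (coprime? j (suc k)) * multiples (suc k) xs) (λ j → unlessCoprime (coprime? j (suc k)) xs) ⟩
      ∑< (suc k) (λ j → indicator (coprime? j (suc k)) * multiples (suc k) xs) + noncoprimeTerms xs
        ≡⟨ cong (_+ noncoprimeTerms xs) (∑<-*ʳ (suc k) (λ j → indicator (coprime? j (suc k))) (multiples (suc k) xs)) ⟩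
      coprimes * multiples (suc k) xs + noncoprimeTerms xs
        ∎
      where
      open ≡.≡-Reasoning
      split-term : ∀ j (c? : Dec (Coprime j (suc k))) → multiples (order j) xs ≡ indicator c? * multiples (suc k) xs + unlessCoprime c? xs
      split-term j (yes coprime) = ≡.trans (cong (λ d → multiples d xs) (order-coprime j coprime)) (≡.sym (≡.trans (+-identityʳ _) (+-identityʳ _)))
      split-term j (no  _)       = ≡.refl

  SameMultiples : List ℕ → List ℕ → Set
  SameMultiples ms ms′ = ∀ d → multiples (suc d) ms ≡ multiples (suc d) ms′

  -- Strong induction on k: noncoprimeTerms only involves orders below suc k, and coprimes > 0.
  cycleCount⇒SameMultiples : ∀ {ms ms′} → (∀ k → cycleCount (suc k) ms ≡ cycleCount (suc k) ms′) → SameMultiples ms ms′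
  cycleCount⇒SameMultiples {ms} {ms′} same = <-rec (λ k → multiples (suc k) ms ≡ multiples (suc k) ms′) step
    where
    step : ∀ k → (∀ {d} → d < k → multiples (suc d) ms ≡ multiples (suc d) ms′) → multiples (suc k) ms ≡ multiples (suc k) ms′
    step k ih = *-cancelˡ-≡ _ _ coprimes {{>-nonZero coprimes-positive}} (+-cancelʳ-≡ (noncoprimeTerms ms) _ _ (begin
      coprimes * multiples (suc k) ms + noncoprimeTerms ms     ≡⟨ cycleCount-split ms ⟨
      cycleCount (suc k) ms                                     ≡⟨ same k ⟩
      cycleCount (suc k) ms′                                    ≡⟨ cycleCount-split ms′ ⟩
      coprimes * multiples (suc k) ms′ + noncoprimeTerms ms′   ≡⟨ cong (coprimes * multiples (suc k) ms′ +_) noncoprimeTerms-same ⟨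
      coprimes * multiples (suc k) ms′ + noncoprimeTerms ms    ∎))
      where
      open ≡.≡-Reasoning
      open Order k
      below : ∀ o → 0 < o → o < suc k → multiples o ms ≡ multiples o ms′
      below (suc d) _ (s≤s d<k) = ih d<k
      term-same : ∀ j (c? : Dec (Coprime j (suc k))) → unlessCoprime c? ms ≡ unlessCoprime c? ms′
      term-same j (yes _)       = ≡.refl
      term-same j (no ¬coprime) = below (order j) (order-positive j) (order-< j ¬coprime)
      noncoprimeTerms-same : noncoprimeTerms ms ≡ noncoprimeTerms ms′
      noncoprimeTerms-same = ∑<-cong (suc k) (λ j → term-same j (coprime? j (suc k)))

  multiples-↭ : ∀ d {xs ys} → xs ↭ ys → multiples d xs ≡ multiples d ys
  multiples-↭ d xs↭ys = ↭-length (filter-↭ (λ m → d ∣? suc m) xs↭ys)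

  multiples-positive : ∀ d {m ms} → m ∈ ms → d ∣ suc m → 0 < multiples d ms
  multiples-positive d m∈ms d∣m = filter-some (λ m → d ∣? suc m) (Any.map (λ { ≡.refl → d∣m }) m∈ms)

  multiples-witness : ∀ d ms → 0 < multiples d ms → ∃ λ m → m ∈ ms × d ∣ suc m
  multiples-witness d ms positive with Any.any? (λ m → d ∣? suc m) ms
  ... | yes some = find some
  ... | no  none = ⊥-elim (<-irrefl (≡.sym (cong length (filter-none (λ m → d ∣? suc m) (¬Any⇒All¬ ms none)))) positive)

  max-shared : ∀ {M ms ms′} → SameMultiples ms ms′ → All (_≤ M) ms′ → M ∈ ms → M ∈ ms′
  max-shared {M} {ms} {ms′} same bound M∈ms with multiples-witness (suc M) ms′ (≡.subst (0 <_) (same M) (multiples-positive (suc M) M∈ms ∣-refl))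
  ... | m , m∈ms′ , M∣m = ≡.subst (_∈ ms′) (≤-antisym (All.lookup bound m∈ms′) (≤-pred (∣⇒≤ M∣m))) m∈ms′

  extract : ∀ {M : ℕ} {ms} → M ∈ ms → ∃ λ rest → ms ↭ M ∷ rest
  extract M∈ms with ys , zs , ≡.refl ← ∈-∃++ M∈ms = ys List.++ zs , shift _ ys zs

  max-of : ∀ x xs → ∃ λ M → M ∈ x ∷ xs × All (_≤ M) (x ∷ xs)
  max-of x xs = max x xs , argmax-all id (here ≡.refl) (All.tabulate there) , ⊥≤max x xs ∷ xs≤max x xs

  -- The largest entry M of ms ++ ms′ is the only candidate m with suc M ∣ suc m, so by
  -- SameMultiples it occurs on both sides; remove it and recurse.
  ↭-from-SameMultiples : ∀ {ms ms′} → SameMultiples ms ms′ → ms ↭ ms′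
  ↭-from-SameMultiples = <-rec (λ n → ∀ {ms ms′} → length ms ≡ n → SameMultiples ms ms′ → ms ↭ ms′) step _ ≡.refl
    where
    Hypothesis : ℕ → Set
    Hypothesis n = ∀ {n′} → n′ < n → ∀ {ms ms′} → length ms ≡ n′ → SameMultiples ms ms′ → ms ↭ ms′

    remove-max : ∀ {n} → Hypothesis n → ∀ {ms ms′} → length ms ≡ n → SameMultiples ms ms′ →
                 ∃ (λ M → M ∈ ms List.++ ms′ × All (_≤ M) (ms List.++ ms′)) → ms ↭ ms′
    remove-max rec {ms} {ms′} len same (M , M∈ , bound) =
      ↭-trans ms↭ (↭-trans (↭-prep M (rec shorter ≡.refl same-rest)) (↭-sym ms′↭))
      where
      bounds = All.++⁻ ms bound
      shared : M ∈ ms × M ∈ ms′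
      shared with ∈-++⁻ ms M∈
      ... | inj₁ M∈ms  = M∈ms , max-shared same (proj₂ bounds) M∈ms
      ... | inj₂ M∈ms′ = max-shared (≡.sym ∘ same) (proj₁ bounds) M∈ms′ , M∈ms′
      r  = proj₁ (extract (proj₁ shared))
      ms↭ = proj₂ (extract (proj₁ shared))
      r′ = proj₁ (extract (proj₂ shared))
      ms′↭ = proj₂ (extract (proj₂ shared))
      same-rest : SameMultiples r r′
      same-rest d = +-cancelˡ-≡ (indicator (suc d ∣? suc M)) _ _ (begin
        indicator (suc d ∣? suc M) + multiples (suc d) r   ≡⟨ multiples-∷ (suc d) M r ⟨
        multiples (suc d) (M ∷ r)                          ≡⟨ multiples-↭ (suc d) ms↭ ⟨
        multiples (suc d) ms                               ≡⟨ same d ⟩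
        multiples (suc d) ms′                              ≡⟨ multiples-↭ (suc d) ms′↭ ⟩
        multiples (suc d) (M ∷ r′)                         ≡⟨ multiples-∷ (suc d) M r′ ⟩
        indicator (suc d ∣? suc M) + multiples (suc d) r′  ∎)
        where open ≡.≡-Reasoning
      shorter : length r < _
      shorter = ≤-reflexive (≡.trans (≡.sym (↭-length ms↭)) len)

    step : ∀ n → Hypothesis n → ∀ {ms ms′} → length ms ≡ n → SameMultiples ms ms′ → ms ↭ ms′
    step n rec {[]}     {[]}      _   _    = ↭-refl
    step n rec {m ∷ ms} {ms′}     len same = remove-max rec len same (max-of m (ms List.++ ms′))
    step n rec {[]}     {m ∷ ms′} len same = remove-max rec len same (max-of m ms′)

open CycleCounts using (SameMultiples; cycleCount⇒SameMultiples; ↭-from-SameMultiples)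

2^-injective : ∀ {a b} → 2 ^ a ≡ 2 ^ b → a ≡ b
2^-injective {a} {b} 2^a≡2^b = ≡.trans (≡.sym (⌊log₂[2^n]⌋≡n a)) (≡.trans (cong ⌊log₂_⌋ 2^a≡2^b) (⌊log₂[2^n]⌋≡n b))

module _ {c ℓ : Level} (K : CommutativeRing c ℓ) where
  open CommutativeRing K
  open PowerSetSums K
  open Matrices K
  open PermutationRepresentation K

  natK-+-≈⇒≡ : IsCharZeroField K → ∀ m d → natK K (m Nat.+ d) ≈ natK K m → m Nat.+ d ≡ m
  natK-+-≈⇒≡ charZero m zero    _ = ℕₚ.+-identityʳ m
  natK-+-≈⇒≡ charZero m (suc d) e = ⊥-elim (IsCharZeroField.charZero charZero d
    (identityʳ-unique (natK K m) (natK K (suc d)) (trans (sym (natK-+ m (suc d))) e)))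
    where open import Algebra.Properties.Group +-group using (identityʳ-unique)

  natK-injective : IsCharZeroField K → ∀ {a b} → natK K a ≈ natK K b → a ≡ b
  natK-injective charZero {a} {b} a≈b with ≤-total a b
  ... | inj₁ a≤b with d , ≡.refl ← m≤n⇒∃[o]m+o≡n a≤b = ≡.sym (natK-+-≈⇒≡ charZero a d (sym a≈b))
  ... | inj₂ b≤a with d , ≡.refl ← m≤n⇒∃[o]m+o≡n b≤a = natK-+-≈⇒≡ charZero b d a≈b

  tr-T-^ₚ-similar : ∀ {n} {π σ : Permutation′ n} → Similar K (T K π) (T K σ) → ∀ k → tr (T K (π ^ₚ k)) ≈ tr (T K (σ ^ₚ k))
  tr-T-^ₚ-similar {π = π} {σ} sim k =
    trans (sym (tr-cong (T-⊛^ π k))) (trans (tr-⊛^-similar sim k) (tr-cong (T-⊛^ σ k)))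

  tr-T-cycleProduct : ∀ ms k → tr (T K (cycleProduct ms ^ₚ k)) ≈ natK K (2 ^ cycleCount k ms)
  tr-T-cycleProduct ms k = trans (tr-T (cycleProduct ms ^ₚ k)) (trans
    (∑-cong (powerSet (size ms)) (λ A → ⟦⟧-cong (invariant? _ A) (invariant? _ A)
      (Invariant-cong (cycleProduct-^ₚ ms k) A) (Invariant-cong (≡.sym ∘ cycleProduct-^ₚ ms k) A)))
    (∑ₚ-invariant-blockwise K k ms))

  tr-T-HasCycleType : ∀ {n ms} {ρ : Permutation′ n} → HasCycleType ρ ms → ∀ k → tr (T K (ρ ^ₚ k)) ≈ natK K (2 ^ cycleCount k ms)
  tr-T-HasCycleType {ms = ms} {ρ} ms≅ρ k with ≅⇒≡ ms≅ρ
  ... | ≡.refl = trans (sym (tr-T-^ₚ-similar (Conjugate⇒Similar (≅⇒Conjugate {π = cycleProduct ms} {ρ} ms≅ρ)) k)) (tr-T-cycleProduct ms k)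

theorem3p12 : ∀ {c ℓ} (K : CommutativeRing c ℓ) → IsCharZeroField K →
              (n : ℕ) (π σ : Permutation′ n) →
              Similar K (T K π) (T K σ) → Conjugate π σ
theorem3p12 K charZero n π σ sim with cycleType π | cycleType σ
... | ms , ms≅π | ms′ , ms′≅σ = ≅⇒Conjugate {π = π} {σ} (≅-trans (≅-sym ms≅π) (≅-trans ms≅ms′ ms′≅σ))
  where
  open CommutativeRing K using (setoid)
  open SetoidReasoning setoid
  open Matrices K using (tr)

  same-cycleCounts : ∀ k → cycleCount (suc k) ms ≡ cycleCount (suc k) ms′
  same-cycleCounts k = 2^-injective (natK-injective K charZero (begin
    natK K (2 ^ cycleCount (suc k) ms)     ≈⟨ tr-T-HasCycleType K {ms = ms} {π} ms≅π (suc k) ⟨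
    tr (T K (π ^ₚ suc k))                  ≈⟨ tr-T-^ₚ-similar K sim (suc k) ⟩
    tr (T K (σ ^ₚ suc k))                  ≈⟨ tr-T-HasCycleType K {ms = ms′} {σ} ms′≅σ (suc k) ⟩
    natK K (2 ^ cycleCount (suc k) ms′)    ∎))

  ms≅ms′ : blockwise ms (rotations 1) ≅ blockwise ms′ (rotations 1)
  ms≅ms′ = ↭⇒blockwise-≅ (rotations 1) {ms} {ms′} (↭-from-SameMultiples {ms} {ms′} (cycleCount⇒SameMultiples {ms} {ms′} same-cycleCounts))
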